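{- Let $\Gamma$ be a simplicial complex on $[n]$ and $1\le i<j\le n$. If the Stanley–Reisner ideal $I_\Gamma$ has no minimal monomial generator divisible by $x_ix_j$, then $\mathrm{in}(\varphi_{ij}(I_\Gamma))=I_{\mathrm{Shift}_{ij}(\Gamma)}$.
   Context: $K$ is a field, $S=K[x_1,\dots,x_n]$ with $\deg x_k=1$. For a simplicial complex $\Gamma$ on $[n]$ (all singletons are faces, closed under subsets), $I_\Gamma$ is the ideal generated by $x_F=\prod_{k\in F}x_k$ with $F\notin\Gamma$. $\varphi_{ij}$ is the graded $K$-algebra automorphism of $S$ with $\varphi_{ij}(x_k)=x_k$ for $k\ne j$ and $\varphi_{ij}(x_j)=x_i+x_j$. $\mathrm{in}(I)$ denotes the initial ideal w.r.t. the degree reverse lexicographic order induced by $x_1>\dots>x_n$. For $F\in\Gamma$, $C_{ij}(F)=(F\setminus\{i\})\cup\{j\}$ if $i\in F$, $j\notin F$ and $(F\setminus\{i\})\cup\{j\}\notin\Gamma$, else $C_{ij}(F)=F$; $\mathrm{Shift}_{ij}(\Gamma)=\{C_{ij}(F):F\in\Gamma\}$. -}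

module Defs where

open import Level using (Level; _⊔_; Lift) renaming (suc to lsuc)
open import Algebra.Bundles using (CommutativeRing)
open import Data.Nat as ℕ using (ℕ; zero; suc)
open import Data.Fin as Fin using (Fin)
open import Data.Fin.Subset using (Subset; _⊆_; ⁅_⁆; _∈_; _∉_; ⊤; ⊥)
open import Data.Vec as Vec using (Vec; []; _∷_; lookup; tabulate)
open import Data.Vec.Properties using (≡-dec)
open import Data.Bool using (Bool; true; false; if_then_else_)
open import Data.List as List using (List; []; _∷_; _++_)
open import Data.List.Relation.Unary.All using (All)
open import Data.Product using (Σ; ∃; ∃-syntax; _×_; _,_; proj₂)
open import Data.Sum using (_⊎_)
open import Relation.Nullary using (¬_; Dec; yes; no; does)
open import Relation.Unary using (Decidable)
open import Relation.Binary.PropositionalEquality using (_≡_; _≢_)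

record Field (c ℓ : Level) : Set (lsuc (c ⊔ ℓ)) where
  field
    commutativeRing : CommutativeRing c ℓ
  open CommutativeRing commutativeRing public
  field
    1≉0     : ¬ (1# ≈ 0#)
    inverse : ∀ x → ¬ (x ≈ 0#) → ∃[ y ] (x * y ≈ 1#)

-- Monomials in x_1..x_n (index k : Fin n stands for x_{k+1}) are
-- exponent vectors; deg x_k = 1.

Mono : ℕ → Set
Mono n = Vec ℕ n

deg : ∀ {n} → Mono n → ℕ
deg = Vec.sum

one : ∀ {n} → Mono n
one = Vec.replicate _ 0

_·ᵐ_ : ∀ {n} → Mono n → Mono n → Mono n
a ·ᵐ b = Vec.zipWith ℕ._+_ a b

_∣ᵐ_ : ∀ {n} → Mono n → Mono n → Set
a ∣ᵐ b = ∀ k → lookup a k ℕ.≤ lookup b k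

unitᵐ : ∀ {n} → Fin n → Mono n
unitᵐ k = tabulate (λ l → if does (k Fin.≟ l) then 1 else 0)

squarefree : ∀ {n} → Subset n → Mono n
squarefree F = Vec.map (λ b → if b then 1 else 0) F

-- "the last variable at which a and b differ": rightmost index k with
-- a_k ≢ b_k, and at that index a_k < b_k.
RevLexFirst : ∀ {n} → Mono n → Mono n → Set
RevLexFirst {zero}  []       []       = Data.Empty.⊥
  where import Data.Empty
RevLexFirst {suc n} (a ∷ as) (b ∷ bs) =
  RevLexFirst as bs ⊎ (as ≡ bs × a ℕ.< b)

-- Degree reverse lexicographic order induced by x_1 > ... > x_n:
-- a <drl b  (b is larger) iff deg a < deg b, or the degrees agree and
-- the last nonzero entry of b − a is negative, i.e. at the rightmost
-- index where they differ, b has the smaller exponent.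
_<drl_ : ∀ {n} → Mono n → Mono n → Set
a <drl b = deg a ℕ.< deg b ⊎ (deg a ≡ deg b × RevLexFirst b a)

-- Polynomials over a field K in n variables: finite lists of terms
-- (coefficient, monomial); equality is equality of all coefficients.

module Poly {c ℓ} (K : Field c ℓ) (n : ℕ) where
  open Field K

  Pol : Set c
  Pol = List (Carrier × Mono n)

  coeff : Pol → Mono n → Carrier
  coeff []             m = 0#
  coeff ((a , u) ∷ p)  m with ≡-dec ℕ._≟_ u m
  ... | yes _ = a + coeff p m
  ... | no  _ = coeff p m

  _≋_ : Pol → Pol → Set ℓ
  p ≋ q = ∀ m → coeff p m ≈ coeff q m

  0ₚ : Pol
  0ₚ = []

  1ₚ : Pol
  1ₚ = (1# , one) ∷ []

  mono : Mono n → Pol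
  mono m = (1# , m) ∷ []

  var : Fin n → Pol
  var k = mono (unitᵐ k)

  _+ₚ_ : Pol → Pol → Pol
  p +ₚ q = p ++ q

  _*ₚ_ : Pol → Pol → Pol
  p *ₚ q = List.concatMap (λ { (a , u) → List.map (λ { (b , v) → (a * b , u ·ᵐ v) }) q }) p

  _^ₚ_ : Pol → ℕ → Pol
  p ^ₚ zero    = 1ₚ
  p ^ₚ (suc e) = p *ₚ (p ^ₚ e)

  sumₚ : List Pol → Pol
  sumₚ = List.foldr _+ₚ_ 0ₚ

  prodₚ : ∀ {m} → Vec Pol m → Pol
  prodₚ = Vec.foldr _ _*ₚ_ 1ₚ

  substₚ : (Fin n → Pol) → Pol → Pol
  substₚ σ p = sumₚ (List.map (λ { (a , u) →
                 ((a , one) ∷ []) *ₚ prodₚ (tabulate (λ k → σ k ^ₚ lookup u k)) }) p)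

  φ : Fin n → Fin n → Pol → Pol
  φ i j = substₚ (λ k → if does (k Fin.≟ j) then var i +ₚ var j else var k)

  PSet : Set (lsuc c ⊔ lsuc ℓ)
  PSet = Pol → Set (c ⊔ ℓ)

  ⟨_⟩ : PSet → PSet
  ⟨ G ⟩ f = ∃[ hs ] (All (λ hg → G (proj₂ hg)) hs ×
                     f ≋ sumₚ (List.map (λ { (h , g) → h *ₚ g }) hs))

  φImage : Fin n → Fin n → PSet → PSet
  φImage i j I g = ∃[ f ] (I f × g ≋ φ i j f)

  IsLeadingMono : Pol → Mono n → Set ℓ
  IsLeadingMono f m = ¬ (coeff f m ≈ 0#) × (∀ m′ → m <drl m′ → coeff f m′ ≈ 0#)

  initialIdeal : PSet → PSet
  initialIdeal I = ⟨ (λ g → ∃[ f ] ∃[ m ] (I f × IsLeadingMono f m × g ≡ mono m)) ⟩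

  IsMinimalMonoGen : PSet → Mono n → Set (c ⊔ ℓ)
  IsMinimalMonoGen I m = I (mono m) × (∀ m′ → m′ ∣ᵐ m → m′ ≢ m → ¬ I (mono m′))

record SimplicialComplex (n : ℕ) : Set₁ where
  field
    Face        : Subset n → Set
    face?       : Decidable Face
    down-closed : ∀ {F G} → G ⊆ F → Face F → Face G
    singletons  : ∀ k → Face ⁅ k ⁆

module _ {c ℓ} (K : Field c ℓ) {n : ℕ} where
  open Poly K n

  SR-ideal : (Subset n → Set) → PSet
  SR-ideal Δ = ⟨ (λ g → Lift (c ⊔ ℓ) (∃[ F ] (¬ Δ F × g ≡ mono (squarefree F)))) ⟩

module _ {n : ℕ} (Γ : SimplicialComplex n) (i j : Fin n) where
  open SimplicialComplex Γ
  open import Data.Fin.Subset using (_-_; _∪_)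
  open import Data.Fin.Subset.Properties using (_∈?_)
  open import Relation.Nullary using (_×-dec_; ¬?)

  swapIJ : Subset n → Subset n
  swapIJ F = (F - i) ∪ ⁅ j ⁆

  C : Subset n → Subset n
  C F with (i ∈? F) ×-dec ((¬? (j ∈? F)) ×-dec (¬? (face? (swapIJ F))))
  ... | yes _ = swapIJ F
  ... | no  _ = F

  Shift : Subset n → Set
  Shift G = ∃[ F ] (Face F × C F ≡ G)

-- Call monomials of the same (i, j)-block if they agree off x_i, x_j and have the same degree in x_i, x_j.
-- φ_ij maps x^u into the span of the block of u, with coefficient 1 at its top x^u (x_i / x_j)^(u_j), and
-- for i < j degrevlex orders each block by decreasing exponent of x_j. Every element of I_Γ is a combination
-- of monomials with non-face support. If x^m leads φ_ij(f), f ∈ I_Γ, and supp m ∈ Shift_ij(Γ), then either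
-- supp m is a face and no monomial of f reaches x^m (here the hypothesis enters, as: H is a face as soon as
-- H ∖ {i} and H ∖ {j} are), or x_i ∤ x^m and supp m = C_ij(F) for a face F. In the latter case every monomial
-- of f in the block of m is divisible by x_j, and the functional v ↦ (-1)^(v_j) on that block, which kills
-- φ_ij(x^u) whenever x_j ∣ x^u, isolates ± the coefficient of x^m in φ_ij(f).
-- Conversely every non-face G of Shift_ij(Γ) contains some H such that x_H leads φ_ij(x_F) for a non-face F
-- with x_F in the block of x_H, or leads φ_ij(x_G − x_B) with B = (G ∖ {j}) ∪ {i}.

module Submission where

open import Defs
open import Algebra.Bundles using (CommutativeMonoid)
open import Level using (Level; Lift; lift; _⊔_)
open import Data.Bool using (true; false; if_then_else_)
import Data.Bool.Properties as Boolₚ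
open import Function.Bundles using (Equivalence)
open import Data.Empty using (⊥-elim)
open import Data.Unit using (⊤)
open import Function using (_∘_; id)
open import Data.List as List using (List; []; _∷_; _++_)
open import Data.List.Membership.Propositional using () renaming (_∈_ to _∈ₗ_)
open import Data.List.Relation.Unary.Any using (here; there)
open import Data.List.Membership.Propositional.Properties using (∈-++⁻; ∈-map⁻; ∈-allFin)
open import Data.List.Relation.Unary.All as All using (All; []; _∷_)
open import Data.Fin as Fin using (Fin; toℕ; fromℕ<; _≟_)
open import Data.Fin.Subset using (Subset; _∈_; _∉_; _⊆_; _∪_; _─_; _-_; ⁅_⁆)
import Data.Fin.Subset.Properties as Subsetₚ
import Data.Fin.Properties as Finₚ
open import Data.Nat as ℕ using (ℕ; zero; suc; z≤n; s≤s)
import Data.Nat.Properties as ℕₚ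
import Algebra.Properties.CommutativeSemigroup ℕₚ.+-commutativeSemigroup as ℕ+
open import Data.Product using (_×_; _,_; proj₁; proj₂; Σ; ∃; ∃-syntax)
open import Data.Sum using (_⊎_; inj₁; inj₂; [_,_]′)
open import Data.Vec as Vec using (Vec; []; _∷_; lookup; tabulate; _[_]≔_)
import Data.Vec.Properties as Vecₚ
open import Data.Vec.Relation.Binary.Pointwise.Extensional using (ext; Pointwise-≡⇒≡)
open import Relation.Nullary using (¬_; Dec; yes; no; does)
open import Relation.Nullary.Decidable using (dec-true; dec-false; _×-dec_; _→-dec_; ¬?)
open import Relation.Binary.PropositionalEquality as ≡ using (_≡_; _≢_)

-- Finite sets and exponent vectors
module _ {n : ℕ} where

  x∈p-y⇒x≢y : ∀ {p : Subset n} {x y} → x ∈ p - y → x ≢ y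
  x∈p-y⇒x≢y {p} {y = y} x∈ ≡.refl = ∉─ p ⁅ y ⁆ x∈ (Subsetₚ.x∈⁅x⁆ y)
    where
    ∉─ : ∀ {m} (p q : Subset m) {x} → x ∈ p ─ q → x ∉ q
    ∉─ (_ ∷ p) (_ ∷ q) (Vec.there x∈) (Vec.there x∈q) = ∉─ p q x∈ x∈q

  x∉p-x : ∀ {p : Subset n} {x} → x ∉ p - x
  x∉p-x x∈ = x∈p-y⇒x≢y x∈ ≡.refl

  exchange : Fin n → Fin n → Subset n → Subset n
  exchange a b F = (F - a) ∪ ⁅ b ⁆

  ∈-exchange⁺ : ∀ {a b F x} → (x ∈ F × x ≢ a) ⊎ x ≡ b → x ∈ exchange a b F
  ∈-exchange⁺ (inj₁ (x∈F , x≢a))         = Subsetₚ.p⊆p∪q _ (Subsetₚ.x∈p∧x≢y⇒x∈p-y x∈F x≢a)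
  ∈-exchange⁺ {a} {F = F} (inj₂ ≡.refl)  = Subsetₚ.q⊆p∪q (F - a) _ (Subsetₚ.x∈⁅x⁆ _)

  ∈-exchange⁻ : ∀ {a b F x} → x ∈ exchange a b F → (x ∈ F × x ≢ a) ⊎ x ≡ b
  ∈-exchange⁻ {a} {b} {F} x∈ with Subsetₚ.x∈p∪q⁻ (F - a) ⁅ b ⁆ x∈
  ... | inj₁ x∈F-a = inj₁ (Subsetₚ.p─q⊆p F ⁅ a ⁆ x∈F-a , x∈p-y⇒x≢y x∈F-a)
  ... | inj₂ x∈⁅b⁆ = inj₂ (Subsetₚ.x∈⁅y⁆⇒x≡y b x∈⁅b⁆)

  ∉-exchange : ∀ {a b F} → a ≢ b → a ∉ exchange a b F
  ∉-exchange a≢b a∈ = [ (λ (_ , a≢a) → a≢a ≡.refl) , a≢b ]′ (∈-exchange⁻ a∈)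

  exchange-exchange-⊆ : ∀ {a b G} → b ∈ G → exchange a b (exchange b a G) ⊆ G
  exchange-exchange-⊆ b∈G x∈ with ∈-exchange⁻ x∈
  ... | inj₂ ≡.refl = b∈G
  ... | inj₁ (x∈′ , x≢a) with ∈-exchange⁻ x∈′
  ...   | inj₁ (x∈G , _) = x∈G
  ...   | inj₂ x≡a       = ⊥-elim (x≢a x≡a)

  exchange-exchange : ∀ {a b G} → b ∈ G → a ∉ G → exchange a b (exchange b a G) ≡ G
  exchange-exchange {a} {b} {G} b∈G a∉G = Subsetₚ.⊆-antisym (exchange-exchange-⊆ b∈G) G⊆
    where
    G⊆ : G ⊆ exchange a b (exchange b a G)
    G⊆ {x} x∈G with x ≟ b
    ... | yes x≡b = ∈-exchange⁺ (inj₂ x≡b)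
    ... | no x≢b  = ∈-exchange⁺ (inj₁ (∈-exchange⁺ (inj₁ (x∈G , x≢b)) , λ { ≡.refl → a∉G x∈G }))

module Exponents where
  open import Data.Nat using (_+_; _∸_; _≤_; _<_)
  open ≡ using (refl)

  module _ {n : ℕ} where

    lookup-ext : ∀ {u v : Vec ℕ n} → (∀ k → lookup u k ≡ lookup v k) → u ≡ v
    lookup-ext h = Pointwise-≡⇒≡ (ext h)

    lookup-·ᵐ : ∀ (u v : Mono n) k → lookup (u ·ᵐ v) k ≡ lookup u k + lookup v k
    lookup-·ᵐ u v k = Vecₚ.lookup-zipWith _+_ k u v

    lookup-one : ∀ k → lookup (one {n}) k ≡ 0
    lookup-one k = Vecₚ.lookup-replicate k 0

    ·ᵐ-identityˡ : ∀ (u : Mono n) → one ·ᵐ u ≡ u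
    ·ᵐ-identityˡ = Vecₚ.zipWith-identityˡ ℕₚ.+-identityˡ

    ·ᵐ-assoc : ∀ (u v w : Mono n) → (u ·ᵐ v) ·ᵐ w ≡ u ·ᵐ (v ·ᵐ w)
    ·ᵐ-assoc = Vecₚ.zipWith-assoc ℕₚ.+-assoc

    lookup-unitᵐ : ∀ k l → lookup (unitᵐ {n} k) l ≡ (if does (k ≟ l) then 1 else 0)
    lookup-unitᵐ k l = Vecₚ.lookup∘tabulate _ l

    lookup-unitᵐ-self : ∀ k → lookup (unitᵐ {n} k) k ≡ 1
    lookup-unitᵐ-self k rewrite lookup-unitᵐ k k | dec-true (k ≟ k) refl = refl

    lookup-unitᵐ-other : ∀ {k l} → k ≢ l → lookup (unitᵐ {n} k) l ≡ 0
    lookup-unitᵐ-other {k} {l} k≢l rewrite lookup-unitᵐ k l with k ≟ l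
    ... | yes k≡l = ⊥-elim (k≢l k≡l)
    ... | no _    = refl

    -- by truncated subtraction; this is the quotient x / b only when b ∣ᵐ x
    _/ᵐ_ : Mono n → Mono n → Mono n
    x /ᵐ b = Vec.zipWith _∸_ x b

    /ᵐ-·ᵐ : ∀ {b x : Mono n} → b ∣ᵐ x → (x /ᵐ b) ·ᵐ b ≡ x
    /ᵐ-·ᵐ {b} {x} b∣x = lookup-ext λ k → begin
      lookup ((x /ᵐ b) ·ᵐ b) k     ≡⟨ lookup-·ᵐ (x /ᵐ b) b k ⟩
      lookup (x /ᵐ b) k + lookup b k ≡⟨ ≡.cong (_+ lookup b k) (Vecₚ.lookup-zipWith _∸_ k x b) ⟩
      lookup x k ∸ lookup b k + lookup b k ≡⟨ ℕₚ.m∸n+n≡m (b∣x k) ⟩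
      lookup x k ∎
      where open ≡.≡-Reasoning

  module _ {n : ℕ} where

    support : Mono n → Subset n
    support v = tabulate (λ k → 0 ℕ.<ᵇ lookup v k)

    ∈-support⁺ : ∀ {v k} → 0 < lookup v k → k ∈ support v
    ∈-support⁺ {v = v} {k} vₖ>0 = Vecₚ.lookup⇒[]= k (support v)
      (≡.trans (Vecₚ.lookup∘tabulate _ k) (Equivalence.to Boolₚ.T-≡ (ℕₚ.<⇒<ᵇ vₖ>0)))

    ∈-support⁻ : ∀ {v k} → k ∈ support v → 0 < lookup v k
    ∈-support⁻ {v = v} {k} k∈ = ℕₚ.<ᵇ⇒< 0 (lookup v k)
      (Equivalence.from Boolₚ.T-≡ (≡.trans (≡.sym (Vecₚ.lookup∘tabulate (λ k → 0 ℕ.<ᵇ lookup v k) k)) (Vecₚ.[]=⇒lookup k∈)))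

    lookup-squarefree-∈ : ∀ {F k} → k ∈ F → lookup (squarefree {n} F) k ≡ 1
    lookup-squarefree-∈ {F} {k} k∈F rewrite Vecₚ.lookup-map k (λ b → if b then 1 else 0) F | Vecₚ.[]=⇒lookup k∈F = refl

    lookup-squarefree-∉ : ∀ {F k} → k ∉ F → lookup (squarefree {n} F) k ≡ 0
    lookup-squarefree-∉ {F} {k} k∉F rewrite Vecₚ.lookup-map k (λ b → if b then 1 else 0) F with lookup F k in Fₖ≡
    ... | true  = ⊥-elim (k∉F (Vecₚ.lookup⇒[]= k F Fₖ≡))
    ... | false = refl

    squarefree-∣ᵐ : ∀ {H G} → H ⊆ G → squarefree {n} H ∣ᵐ squarefree G
    squarefree-∣ᵐ {H} {G} H⊆G k with k Subsetₚ.∈? H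
    ... | yes k∈H = ℕₚ.≤-reflexive (≡.trans (lookup-squarefree-∈ k∈H) (≡.sym (lookup-squarefree-∈ (H⊆G k∈H))))
    ... | no  k∉H = ≡.subst (_≤ lookup (squarefree G) k) (≡.sym (lookup-squarefree-∉ k∉H)) z≤n

    squarefree-support-∣ᵐ : ∀ v → squarefree (support v) ∣ᵐ v
    squarefree-support-∣ᵐ v k with k Subsetₚ.∈? support v
    ... | yes k∈ = ≡.subst (_≤ lookup v k) (≡.sym (lookup-squarefree-∈ k∈)) (∈-support⁻ {v = v} k∈)
    ... | no  k∉ = ≡.subst (_≤ lookup v k) (≡.sym (lookup-squarefree-∉ k∉)) z≤n

    ⊆-support-·ᵐ-squarefree : ∀ u F → F ⊆ support (u ·ᵐ squarefree {n} F)
    ⊆-support-·ᵐ-squarefree u F {x} x∈F = ∈-support⁺ {v = u ·ᵐ squarefree F}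
      (≡.subst (0 <_) (≡.sym (≡.trans (lookup-·ᵐ u (squarefree F) x) (≡.cong (lookup u x +_) (lookup-squarefree-∈ x∈F))))
               (ℕₚ.m≤n+m 1 (lookup u x)))

    support-⊆ : ∀ {v F} → v ∣ᵐ squarefree F → support v ⊆ F
    support-⊆ {v} {F} v∣ {x} x∈ with x Subsetₚ.∈? F
    ... | yes x∈F = x∈F
    ... | no  x∉F = ⊥-elim (ℕₚ.<⇒≱ (∈-support⁻ {v = v} x∈) (≡.subst (lookup v x ≤_) (lookup-squarefree-∉ x∉F) (v∣ x)))

    properDivisor-squarefree : ∀ {v F} → v ∣ᵐ squarefree F → v ≢ squarefree F → Σ (Fin n) λ k → k ∈ F × support v ⊆ F - k
    properDivisor-squarefree {v} {F} v∣ v≢ with Finₚ.all? (λ k → k Subsetₚ.∈? F →-dec 0 ℕ.<? lookup v k)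
    ... | yes full = ⊥-elim (v≢ (lookup-ext coord))
      where
      coord : ∀ k → lookup v k ≡ lookup (squarefree F) k
      coord k with k Subsetₚ.∈? F
      ... | yes k∈F = ℕₚ.≤-antisym (v∣ k) (≡.subst (_≤ lookup v k) (≡.sym (lookup-squarefree-∈ k∈F)) (full k k∈F))
      ... | no  k∉F = ℕₚ.≤-antisym (v∣ k) (≡.subst (_≤ lookup v k) (≡.sym (lookup-squarefree-∉ k∉F)) z≤n)
    ... | no ¬full with Finₚ.¬∀⟶∃¬ n _ (λ k → k Subsetₚ.∈? F →-dec 0 ℕ.<? lookup v k) ¬full
    ...   | k , ¬[k∈F⇒vₖ>0] = k , k∈F , λ x∈ →
      Subsetₚ.x∈p∧x≢y⇒x∈p-y (support-⊆ {v = v} v∣ x∈) (λ { ≡.refl → ¬[k∈F⇒vₖ>0] (λ _ → ∈-support⁻ {v = v} x∈) })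
      where
      k∈F : k ∈ F
      k∈F with k Subsetₚ.∈? F
      ... | yes k∈F = k∈F
      ... | no  k∉F = ⊥-elim (¬[k∈F⇒vₖ>0] (λ k∈F → ⊥-elim (k∉F k∈F)))

    unitᵐ·unitᵐ-∣ᵐ-squarefree : ∀ {k l F} → k ≢ l → k ∈ F → l ∈ F → (unitᵐ k ·ᵐ unitᵐ l) ∣ᵐ squarefree {n} F
    unitᵐ·unitᵐ-∣ᵐ-squarefree {k} {l} k≢l k∈F l∈F x rewrite lookup-·ᵐ (unitᵐ k) (unitᵐ l) x with x ≟ k | x ≟ l
    ... | yes ≡.refl | _ rewrite lookup-unitᵐ-self x | lookup-unitᵐ-other (k≢l ∘ ≡.sym) | lookup-squarefree-∈ k∈F = ℕₚ.≤-refl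
    ... | no x≢k | yes ≡.refl rewrite lookup-unitᵐ-self x | lookup-unitᵐ-other (x≢k ∘ ≡.sym) | lookup-squarefree-∈ l∈F = ℕₚ.≤-refl
    ... | no x≢k | no x≢l rewrite lookup-unitᵐ-other (x≢k ∘ ≡.sym) | lookup-unitᵐ-other (x≢l ∘ ≡.sym) = z≤n

  sum-[]≔ : ∀ {n} (xs : Vec ℕ n) k x → Vec.sum (xs [ k ]≔ x) + lookup xs k ≡ Vec.sum xs + x
  sum-[]≔ (y ∷ xs) Fin.zero    x = ℕ+.xy∙z≈zy∙x x (Vec.sum xs) y
  sum-[]≔ (y ∷ xs) (Fin.suc k) x = begin
    y + Vec.sum (xs [ k ]≔ x) + lookup xs k   ≡⟨ ℕₚ.+-assoc y _ _ ⟩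
    y + (Vec.sum (xs [ k ]≔ x) + lookup xs k) ≡⟨ ≡.cong (y +_) (sum-[]≔ xs k x) ⟩
    y + (Vec.sum xs + x)                      ≡⟨ ℕₚ.+-assoc y _ x ⟨
    y + Vec.sum xs + x                        ∎
    where open ≡.≡-Reasoning

  revLexFirst⁺ : ∀ {n} (a b : Vec ℕ n) k → lookup a k < lookup b k →
                 (∀ l → toℕ k < toℕ l → lookup a l ≡ lookup b l) → RevLexFirst a b
  revLexFirst⁺ (_ ∷ as) (_ ∷ bs) Fin.zero    a<b later = inj₂ (lookup-ext (λ l → later (Fin.suc l) (s≤s z≤n)) , a<b)
  revLexFirst⁺ (_ ∷ as) (_ ∷ bs) (Fin.suc k) a<b later = inj₁ (revLexFirst⁺ as bs k a<b (λ l k<l → later (Fin.suc l) (s≤s k<l)))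

  revLexFirst⁻ : ∀ {n} (a b : Vec ℕ n) → RevLexFirst a b →
                 ∃ λ k → lookup a k < lookup b k × (∀ l → toℕ k < toℕ l → lookup a l ≡ lookup b l)
  revLexFirst⁻ [] [] ()
  revLexFirst⁻ (_ ∷ as) (_ ∷ bs) (inj₁ r) with revLexFirst⁻ as bs r
  ... | k , a<b , later = Fin.suc k , a<b , λ { Fin.zero () ; (Fin.suc l) (s≤s k<l) → later l k<l }
  revLexFirst⁻ (_ ∷ as) (_ ∷ bs) (inj₂ (as≡bs , a<b)) =
    Fin.zero , a<b , λ { Fin.zero () ; (Fin.suc l) _ → ≡.cong (λ v → lookup v l) as≡bs }

  dot : ∀ {m} → (Fin m → ℕ) → Vec ℕ m → ℕ
  dot a []      = 0
  dot a (e ∷ v) = e ℕ.* a Fin.zero + dot (a ∘ Fin.suc) v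

  dot-+ : ∀ {m} (a b : Fin m → ℕ) v → dot (λ k → a k + b k) v ≡ dot a v + dot b v
  dot-+ a b []      = refl
  dot-+ a b (e ∷ v) = begin
    e ℕ.* (a₀ + b₀) + dot (λ k → a (Fin.suc k) + b (Fin.suc k)) v
      ≡⟨ ≡.cong₂ _+_ (ℕₚ.*-distribˡ-+ e a₀ b₀) (dot-+ (a ∘ Fin.suc) (b ∘ Fin.suc) v) ⟩
    (e ℕ.* a₀ + e ℕ.* b₀) + (dot (a ∘ Fin.suc) v + dot (b ∘ Fin.suc) v) ≡⟨ ℕ+.interchange (e ℕ.* a₀) (e ℕ.* b₀) _ _ ⟩
    (e ℕ.* a₀ + dot (a ∘ Fin.suc) v) + (e ℕ.* b₀ + dot (b ∘ Fin.suc) v) ∎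
    where
    open ≡.≡-Reasoning
    a₀ = a Fin.zero
    b₀ = b Fin.zero

  dot-cong : ∀ {m} {a b : Fin m → ℕ} v → (∀ k → a k ≡ b k) → dot a v ≡ dot b v
  dot-cong []      a≗b = refl
  dot-cong (e ∷ v) a≗b = ≡.cong₂ _+_ (≡.cong (e ℕ.*_) (a≗b Fin.zero)) (dot-cong v (a≗b ∘ Fin.suc))

  dot-indicator : ∀ {m} (l : Fin m) v → dot (λ k → if does (k ≟ l) then 1 else 0) v ≡ lookup v l
  dot-indicator Fin.zero    (e ∷ v) = ≡.trans (≡.cong₂ _+_ (ℕₚ.*-identityʳ e) (dot-zero v)) (ℕₚ.+-identityʳ e)
    where
    dot-zero : ∀ {m} (v : Vec ℕ m) → dot (λ _ → 0) v ≡ 0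
    dot-zero []      = refl
    dot-zero (e ∷ v) = ≡.cong₂ _+_ (ℕₚ.*-zeroʳ e) (dot-zero v)
  dot-indicator (Fin.suc l) (e ∷ v) = ≡.trans (≡.cong (_+ dot (λ k → if does (k ≟ l) then 1 else 0) v) (ℕₚ.*-zeroʳ e)) (dot-indicator l v)

  dot-unitᵐ : ∀ {n} (l : Fin n) v → dot (λ k → lookup (unitᵐ k) l) v ≡ lookup v l
  dot-unitᵐ l v = ≡.trans (dot-cong v (λ k → lookup-unitᵐ k l)) (dot-indicator l v)

open Exponents

-- Blocks of monomials
module Block {n : ℕ} (i j : Fin n) (i≢j : i ≢ j) where
  open import Data.Nat using (_+_; _∸_; _≤_; _<_)
  open ≡ using (refl)

  ijDeg : Mono n → ℕ
  ijDeg u = lookup u i + lookup u j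

  -- The monomials of φ_ij(x^u) all lie in the block of u.
  record SameBlock (u v : Mono n) : Set where
    constructor sameBlock
    field
      agree-off : ∀ l → l ≢ i → l ≢ j → lookup v l ≡ lookup u l
      ijDeg-eq  : ijDeg v ≡ ijDeg u

  open SameBlock public

  SameBlock-refl : ∀ {u} → SameBlock u u
  SameBlock-refl = sameBlock (λ _ _ _ → refl) refl

  SameBlock-sym : ∀ {u v} → SameBlock u v → SameBlock v u
  SameBlock-sym (sameBlock agree eq) = sameBlock (λ l l≢i l≢j → ≡.sym (agree l l≢i l≢j)) (≡.sym eq)

  SameBlock-trans : ∀ {u v w} → SameBlock u v → SameBlock v w → SameBlock u w
  SameBlock-trans (sameBlock agree eq) (sameBlock agree′ eq′) =
    sameBlock (λ l l≢i l≢j → ≡.trans (agree′ l l≢i l≢j) (agree l l≢i l≢j)) (≡.trans eq′ eq)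

  sameBlock? : ∀ u v → Dec (SameBlock u v)
  sameBlock? u v with Finₚ.all? (λ l → ¬? (l ≟ i) →-dec ¬? (l ≟ j) →-dec lookup v l ℕ.≟ lookup u l)
                      ×-dec ijDeg v ℕ.≟ ijDeg u
  ... | yes (agree , eq) = yes (sameBlock agree eq)
  ... | no ¬same         = no λ { (sameBlock agree eq) → ¬same (agree , eq) }

  SameBlock-≡ⁱ : ∀ {u v} → SameBlock u v → lookup v i ≡ lookup u i → v ≡ u
  SameBlock-≡ⁱ {u} {v} (sameBlock agree eq) vi≡ui = lookup-ext coord
    where
    vj≡uj : lookup v j ≡ lookup u j
    vj≡uj = ℕₚ.+-cancelˡ-≡ (lookup u i) _ _ (≡.subst (λ x → x + lookup v j ≡ ijDeg u) vi≡ui eq)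
    coord : ∀ l → lookup v l ≡ lookup u l
    coord l with l ≟ i | l ≟ j
    ... | yes refl | _        = vi≡ui
    ... | no _     | yes refl = vj≡uj
    ... | no l≢i   | no l≢j   = agree l l≢i l≢j

  SameBlock-≡ʲ : ∀ {u v} → SameBlock u v → lookup v j ≡ lookup u j → v ≡ u
  SameBlock-≡ʲ {u} {v} b vj≡uj = SameBlock-≡ⁱ b
    (ℕₚ.+-cancelʳ-≡ (lookup u j) _ _ (≡.subst (λ x → lookup v i + x ≡ ijDeg u) vj≡uj (ijDeg-eq b)))

  lookupⁱ≤ijDeg : ∀ {m v} → SameBlock m v → lookup v i ≤ ijDeg m
  lookupⁱ≤ijDeg {v = v} b = ≡.subst (lookup v i ≤_) (ijDeg-eq b) (ℕₚ.m≤m+n _ _)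

  blockMono : Mono n → ℕ → Mono n
  blockMono m p = (m [ i ]≔ p) [ j ]≔ (ijDeg m ∸ p)

  blockMonoⁱ : ∀ m p → lookup (blockMono m p) i ≡ p
  blockMonoⁱ m p = ≡.trans (Vecₚ.lookup∘update′ i≢j (m [ i ]≔ p) _) (Vecₚ.lookup∘update i m p)

  blockMonoʲ : ∀ m p → lookup (blockMono m p) j ≡ ijDeg m ∸ p
  blockMonoʲ m p = Vecₚ.lookup∘update j (m [ i ]≔ p) _

  SameBlock-blockMono : ∀ m {p} → p ≤ ijDeg m → SameBlock m (blockMono m p)
  SameBlock-blockMono m {p} p≤ = sameBlock agree
    (≡.trans (≡.cong₂ _+_ (blockMonoⁱ m p) (blockMonoʲ m p)) (ℕₚ.m+[n∸m]≡n p≤))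
    where
    agree : ∀ l → l ≢ i → l ≢ j → lookup (blockMono m p) l ≡ lookup m l
    agree l l≢i l≢j = ≡.trans (Vecₚ.lookup∘update′ l≢j (m [ i ]≔ p) _) (Vecₚ.lookup∘update′ l≢i m p)

  ≡-blockMono : ∀ {m v} → SameBlock m v → v ≡ blockMono m (lookup v i)
  ≡-blockMono {m} {v} b = ≡.sym (SameBlock-≡ⁱ
    (SameBlock-trans (SameBlock-sym b) (SameBlock-blockMono m (lookupⁱ≤ijDeg b)))
    (blockMonoⁱ m (lookup v i)))

  deg-blockMono : ∀ m {p} → p ≤ ijDeg m → deg (blockMono m p) ≡ deg m
  deg-blockMono m {p} p≤ = ℕₚ.+-cancelʳ-≡ (ijDeg m) _ _ (begin
    deg (blockMono m p) + (lookup m i + lookup m j) ≡⟨ ℕ+.x∙yz≈xz∙y (deg (blockMono m p)) (lookup m i) (lookup m j) ⟩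
    deg (blockMono m p) + lookup m j + lookup m i   ≡⟨ ≡.cong (λ x → deg (blockMono m p) + x + lookup m i) mᵢⱼ ⟨
    deg (blockMono m p) + lookup mᵢ j + lookup m i  ≡⟨ ≡.cong (_+ lookup m i) (sum-[]≔ mᵢ j (ijDeg m ∸ p)) ⟩
    deg mᵢ + (ijDeg m ∸ p) + lookup m i             ≡⟨ ℕ+.xy∙z≈xz∙y (deg mᵢ) (ijDeg m ∸ p) (lookup m i) ⟩
    deg mᵢ + lookup m i + (ijDeg m ∸ p)             ≡⟨ ≡.cong (_+ (ijDeg m ∸ p)) (sum-[]≔ m i p) ⟩
    deg m + p + (ijDeg m ∸ p)                       ≡⟨ ℕₚ.+-assoc (deg m) p _ ⟩
    deg m + (p + (ijDeg m ∸ p))                     ≡⟨ ≡.cong (deg m +_) (ℕₚ.m+[n∸m]≡n p≤) ⟩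
    deg m + ijDeg m                                 ∎)
    where
    open ≡.≡-Reasoning
    mᵢ = m [ i ]≔ p
    mᵢⱼ : lookup mᵢ j ≡ lookup m j
    mᵢⱼ = Vecₚ.lookup∘update′ (≡.≢-sym i≢j) m p

  deg-SameBlock : ∀ {m v} → SameBlock m v → deg v ≡ deg m
  deg-SameBlock {m} {v} b = ≡.trans (≡.cong deg (≡-blockMono b)) (deg-blockMono m (lookupⁱ≤ijDeg b))

  SameBlock-belowʲ : ∀ {m x} → lookup m i ≡ 0 → SameBlock m x → x ≢ m → lookup x j < lookup m j
  SameBlock-belowʲ {m} {x} mᵢ≡0 b x≢m with lookup x i in xᵢ≡
  ... | zero  = ⊥-elim (x≢m (SameBlock-≡ⁱ b (≡.trans xᵢ≡ (≡.sym mᵢ≡0))))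
  ... | suc e = ≡.subst (lookup x j <_) (≡.trans (≡.trans (≡.cong (_+ lookup x j) (≡.sym xᵢ≡)) (ijDeg-eq b)) (≡.cong (_+ lookup m j) mᵢ≡0))
                        (ℕₚ.m<n+m (lookup x j) {suc e} (s≤s z≤n))

  SameBlock-top : ∀ {m u} → lookup m i ≡ 0 → SameBlock m u → lookup m j ≤ lookup u j → u ≡ m
  SameBlock-top {m} {u} mᵢ≡0 b mⱼ≤uⱼ with Vecₚ.≡-dec ℕ._≟_ u m
  ... | yes u≡m = u≡m
  ... | no  u≢m = ⊥-elim (ℕₚ.<⇒≱ (SameBlock-belowʲ mᵢ≡0 b u≢m) mⱼ≤uⱼ)

  ∈-support-SameBlock : ∀ {m u x} → SameBlock m u → x ≢ i → x ≢ j → x ∈ support u → x ∈ support m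
  ∈-support-SameBlock {m} {u} {x} b x≢i x≢j x∈ =
    ∈-support⁺ {v = m} (≡.subst (0 <_) (agree-off b x x≢i x≢j) (∈-support⁻ {v = u} x∈))

  support-SameBlock-⊆ : ∀ {m u} → SameBlock m u → i ∈ support m → support u ⊆ support m ∪ ⁅ j ⁆
  support-SameBlock-⊆ {m} {u} b i∈ {x} x∈ with x ≟ j | x ≟ i
  ... | yes ≡.refl | _          = Subsetₚ.q⊆p∪q (support m) ⁅ j ⁆ (Subsetₚ.x∈⁅x⁆ j)
  ... | no _       | yes ≡.refl = Subsetₚ.p⊆p∪q ⁅ j ⁆ i∈
  ... | no x≢j     | no x≢i     = Subsetₚ.p⊆p∪q ⁅ j ⁆ (∈-support-SameBlock b x≢i x≢j x∈)

  support-SameBlock-⊆-exchange : ∀ {m u} → SameBlock m u → lookup u j ≡ 0 → support u ⊆ exchange j i (support m)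
  support-SameBlock-⊆-exchange {m} {u} b uⱼ≡0 {x} x∈ with x ≟ i | x ≟ j
  ... | yes x≡i    | _          = ∈-exchange⁺ (inj₂ x≡i)
  ... | no _       | yes ≡.refl = ⊥-elim (ℕₚ.<-irrefl (≡.sym uⱼ≡0) (∈-support⁻ {v = u} x∈))
  ... | no x≢i     | no x≢j     = ∈-exchange⁺ (inj₁ (∈-support-SameBlock b x≢i x≢j x∈ , x≢j))

  SameBlock-exchange : ∀ {H} → i ∈ H → j ∉ H → SameBlock (squarefree H) (squarefree (exchange i j H))
  SameBlock-exchange {H} i∈H j∉H = sameBlock agree ijDeg≡
    where
    agree : ∀ l → l ≢ i → l ≢ j → lookup (squarefree (exchange i j H)) l ≡ lookup (squarefree H) l
    agree l l≢i l≢j with l Subsetₚ.∈? H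
    ... | yes l∈H = ≡.trans (lookup-squarefree-∈ (∈-exchange⁺ (inj₁ (l∈H , l≢i)))) (≡.sym (lookup-squarefree-∈ l∈H))
    ... | no  l∉H = ≡.trans (lookup-squarefree-∉ {F = exchange i j H} (λ l∈ → [ l∉H ∘ proj₁ , l≢j ]′ (∈-exchange⁻ l∈)))
                            (≡.sym (lookup-squarefree-∉ l∉H))
    ijDeg≡ : ijDeg (squarefree (exchange i j H)) ≡ ijDeg (squarefree H)
    ijDeg≡ = ≡.trans (≡.cong₂ _+_ (lookup-squarefree-∉ {F = exchange i j H} (∉-exchange i≢j))
                                  (lookup-squarefree-∈ {F = exchange i j H} (∈-exchange⁺ (inj₂ refl))))
                     (≡.sym (≡.cong₂ _+_ (lookup-squarefree-∈ i∈H) (lookup-squarefree-∉ j∉H)))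

  module _ (i<j : toℕ i < toℕ j) where

    -- Within a block, degrevlex is the reverse order of the x_j exponents; this is where i < j is used.
    SameBlock-<drl⇒ : ∀ {m m′} → SameBlock m m′ → m <drl m′ → lookup m′ j < lookup m j
    SameBlock-<drl⇒ b (inj₁ deg<) = ⊥-elim (ℕₚ.<-irrefl (≡.sym (deg-SameBlock b)) deg<)
    SameBlock-<drl⇒ {m} {m′} b (inj₂ (_ , last)) with revLexFirst⁻ m′ m last
    ... | k , m′ₖ<mₖ , later with k ≟ j | k ≟ i
    ...   | yes refl | _        = m′ₖ<mₖ
    ...   | no _     | yes refl = ⊥-elim (ℕₚ.<-irrefl (≡.cong (λ v → lookup v i) (SameBlock-≡ʲ b (later j i<j))) m′ₖ<mₖ)
    ...   | no k≢j   | no k≢i   = ⊥-elim (ℕₚ.<-irrefl (agree-off b k k≢i k≢j) m′ₖ<mₖ)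

    SameBlock-<drl⇐ : ∀ {m m′} → SameBlock m m′ → lookup m′ j < lookup m j → m <drl m′
    SameBlock-<drl⇐ {m} {m′} b m′ⱼ<mⱼ = inj₂ (≡.sym (deg-SameBlock b) , revLexFirst⁺ m′ m j m′ⱼ<mⱼ later)
      where
      later : ∀ l → toℕ j < toℕ l → lookup m′ l ≡ lookup m l
      later l j<l = agree-off b l (λ { refl → ℕₚ.<-asym i<j j<l }) (λ { refl → ℕₚ.<-irrefl refl j<l })

-- Linear functionals on polynomials
module SumProperties {c ℓ} (M : CommutativeMonoid c ℓ) where
  open CommutativeMonoid M renaming (ε to 0#; _∙_ to _+_; ∙-congˡ to +-congˡ; identityʳ to +-identityʳ)
  open import Algebra.Properties.CommutativeMonoid.Sum M using (sum; sum-cong-≋; sum-replicate-zero; sum-remove)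
  open import Relation.Binary.Reasoning.Setoid setoid

  ∑-zero : ∀ {N} (t : Fin N → Carrier) → (∀ p → t p ≈ 0#) → sum t ≈ 0#
  ∑-zero {N} t t≈0 = trans (sum-cong-≋ t≈0) (sum-replicate-zero N)

  ∑-single : ∀ {N} (t : Fin N → Carrier) q → (∀ p → p ≢ q → t p ≈ 0#) → sum t ≈ t q
  ∑-single {suc N} t q t≈0 = begin
    sum t                              ≈⟨ sum-remove {i = q} t ⟩
    t q + sum (t ∘ Fin.punchIn q)      ≈⟨ +-congˡ (∑-zero _ (λ p → t≈0 _ (Finₚ.punchInᵢ≢i q p))) ⟩
    t q + 0#                           ≈⟨ +-identityʳ (t q) ⟩
    t q                                ∎

module Pairing {c ℓ} (K : Field c ℓ) (n : ℕ) where
  open Field K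
  open Poly K n
  open import Algebra.Properties.CommutativeMonoid.Sum +-commutativeMonoid using (sum)
  open import Relation.Binary.Reasoning.Setoid setoid
  import Algebra.Properties.CommutativeSemigroup +-commutativeSemigroup as +ᶜ
  import Algebra.Properties.CommutativeSemigroup *-commutativeSemigroup as ×

  EveryMono : ∀ {a} → (Mono n → Set a) → Pol → Set (c ⊔ a)
  EveryMono P p = ∀ {t} → t ∈ₗ p → P (proj₂ t)

  pairing : (Mono n → Carrier) → Pol → Carrier
  pairing w []            = 0#
  pairing w ((a , u) ∷ p) = a * w u + pairing w p

  δ : Mono n → Mono n → Carrier
  δ m v = if does (Vecₚ.≡-dec ℕ._≟_ v m) then 1# else 0#

  δ-≡ : ∀ {m v} → v ≡ m → δ m v ≈ 1#
  δ-≡ {m} ≡.refl rewrite dec-true (Vecₚ.≡-dec ℕ._≟_ m m) ≡.refl = refl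

  δ-≢ : ∀ {m v} → v ≢ m → δ m v ≈ 0#
  δ-≢ {m} {v} v≢m rewrite dec-false (Vecₚ.≡-dec ℕ._≟_ v m) v≢m = refl

  coeff≈pairing-δ : ∀ p m → coeff p m ≈ pairing (δ m) p
  coeff≈pairing-δ []            m = refl
  coeff≈pairing-δ ((a , u) ∷ p) m with Vecₚ.≡-dec ℕ._≟_ u m
  ... | yes _ = +-cong (sym (*-identityʳ a)) (coeff≈pairing-δ p m)
  ... | no _  = trans (coeff≈pairing-δ p m) (sym (trans (+-congʳ (zeroʳ a)) (+-identityˡ _)))

  pairing-++ : ∀ w p q → pairing w (p ++ q) ≈ pairing w p + pairing w q
  pairing-++ w []            q = sym (+-identityˡ _)
  pairing-++ w ((a , u) ∷ p) q = trans (+-congˡ (pairing-++ w p q)) (sym (+-assoc _ _ _))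

  pairing-cong : ∀ {w w′} p → EveryMono (λ v → w v ≈ w′ v) p → pairing w p ≈ pairing w′ p
  pairing-cong []            _  = refl
  pairing-cong ((a , u) ∷ p) eq = +-cong (*-congˡ (eq (here ≡.refl))) (pairing-cong p (eq ∘ there))

  pairing-zero : ∀ {w} p → EveryMono (λ v → w v ≈ 0#) p → pairing w p ≈ 0#
  pairing-zero []            _  = refl
  pairing-zero ((a , u) ∷ p) w0 = begin
    a * _ + pairing _ p ≈⟨ +-cong (*-congˡ (w0 (here ≡.refl))) (pairing-zero p (w0 ∘ there)) ⟩
    a * 0# + 0#         ≈⟨ +-identityʳ _ ⟩
    a * 0#              ≈⟨ zeroʳ a ⟩
    0#                  ∎

  coeff-zero : ∀ p m → EveryMono (_≢ m) p → coeff p m ≈ 0#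
  coeff-zero p m none = trans (coeff≈pairing-δ p m) (pairing-zero p (δ-≢ ∘ none))

  pairing-*ˡ : ∀ k w p → pairing (λ v → k * w v) p ≈ k * pairing w p
  pairing-*ˡ k w []            = sym (zeroʳ k)
  pairing-*ˡ k w ((a , u) ∷ p) = begin
    a * (k * w u) + pairing (λ v → k * w v) p ≈⟨ +-cong (×.x∙yz≈y∙xz a k (w u)) (pairing-*ˡ k w p) ⟩
    k * (a * w u) + k * pairing w p           ≈⟨ distribˡ k _ _ ⟨
    k * (a * w u + pairing w p)               ∎

  pairing-+ : ∀ w₁ w₂ p → pairing (λ v → w₁ v + w₂ v) p ≈ pairing w₁ p + pairing w₂ p
  pairing-+ w₁ w₂ []            = sym (+-identityˡ 0#)
  pairing-+ w₁ w₂ ((a , u) ∷ p) = begin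
    a * (w₁ u + w₂ u) + pairing _ p                          ≈⟨ +-cong (distribˡ a _ _) (pairing-+ w₁ w₂ p) ⟩
    (a * w₁ u + a * w₂ u) + (pairing w₁ p + pairing w₂ p)    ≈⟨ +ᶜ.interchange _ _ _ _ ⟩
    (a * w₁ u + pairing w₁ p) + (a * w₂ u + pairing w₂ p)    ∎

  -- F stands for the anonymous term map inside _*ₚ_, which cannot be named here.
  pairing-map : ∀ w a u (F : Carrier × Mono n → Carrier × Mono n) → (∀ b v → F (b , v) ≡ (a * b , u ·ᵐ v)) →
                ∀ q → pairing w (List.map F q) ≈ a * pairing (λ v → w (u ·ᵐ v)) q
  pairing-map w a u F F≡ []            = sym (zeroʳ a)
  pairing-map w a u F F≡ ((b , v) ∷ q) rewrite F≡ b v = begin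
    a * b * w (u ·ᵐ v) + pairing w (List.map F q)          ≈⟨ +-cong (*-assoc a b _) (pairing-map w a u F F≡ q) ⟩
    a * (b * w (u ·ᵐ v)) + a * pairing (λ v → w (u ·ᵐ v)) q ≈⟨ distribˡ a _ _ ⟨
    a * (b * w (u ·ᵐ v) + pairing (λ v → w (u ·ᵐ v)) q)     ∎

  pairing-*ₚ : ∀ w p q → pairing w (p *ₚ q) ≈ pairing (λ u → pairing (λ v → w (u ·ᵐ v)) q) p
  pairing-*ₚ w []            q = refl
  pairing-*ₚ w ((a , u) ∷ p) q = trans (pairing-++ w (List.map _ q) (p *ₚ q))
    (+-cong (pairing-map w a u _ (λ _ _ → ≡.refl) q) (pairing-*ₚ w p q))

  pairing-*ₚ-mono : ∀ w p x → pairing w (p *ₚ mono x) ≈ pairing (λ u → w (u ·ᵐ x)) p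
  pairing-*ₚ-mono w p x = trans (pairing-*ₚ w p (mono x)) (pairing-cong p (λ _ → trans (+-identityʳ _) (*-identityˡ _)))

  pairing-scale : ∀ w a q → pairing w (((a , one) ∷ []) *ₚ q) ≈ a * pairing w q
  pairing-scale w a q = begin
    pairing w (((a , one) ∷ []) *ₚ q)              ≈⟨ pairing-*ₚ w ((a , one) ∷ []) q ⟩
    a * pairing (λ v → w (one ·ᵐ v)) q + 0#        ≈⟨ +-identityʳ _ ⟩
    a * pairing (λ v → w (one ·ᵐ v)) q             ≈⟨ *-congˡ (pairing-cong q (λ {t} _ → reflexive (≡.cong w (·ᵐ-identityˡ _)))) ⟩
    a * pairing w q                                ∎

  EveryMono-*ₚ : ∀ {a b d} {P : Mono n → Set a} {Q : Mono n → Set b} {R : Mono n → Set d} p q →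
                 EveryMono P p → EveryMono Q q → (∀ {u v} → P u → Q v → R (u ·ᵐ v)) → EveryMono R (p *ₚ q)
  EveryMono-*ₚ ((a , u) ∷ p) q Pp Qq PQ⇒R t∈ with ∈-++⁻ (List.map _ q) t∈
  ... | inj₂ t∈p*q = EveryMono-*ₚ p q (Pp ∘ there) Qq PQ⇒R t∈p*q
  ... | inj₁ t∈map with ∈-map⁻ _ t∈map
  ...   | (b , v) , v∈q , ≡.refl = PQ⇒R (Pp (here ≡.refl)) (Qq v∈q)

  pairing-mono : ∀ w x → pairing w (mono x) ≈ w x
  pairing-mono w x = trans (+-identityʳ _) (*-identityˡ _)

  IsLeadingMono-cong : ∀ {f g m} → f ≋ g → IsLeadingMono g m → IsLeadingMono f m
  IsLeadingMono-cong f≋g (g≉0 , above) = (λ f≈0 → g≉0 (trans (sym (f≋g _)) f≈0)) , λ m′ m<m′ → trans (f≋g m′) (above m′ m<m′)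

  pairing-∑ : ∀ {N} (W : Fin N → Mono n → Carrier) p →
              pairing (λ v → sum (λ q → W q v)) p ≈ sum (λ q → pairing (W q) p)
  pairing-∑ {zero}  W p = pairing-zero p (λ _ → refl)
  pairing-∑ {suc N} W p = trans (pairing-+ _ _ p) (+-congˡ (pairing-∑ (W ∘ Fin.suc) p))

module Evaluation {c ℓ} (K : Field c ℓ) (n : ℕ) where
  open Field K
  open Poly K n
  open Pairing K n
  open import Algebra.Properties.Semiring.Exp semiring public using (_^_)
  open import Algebra.Properties.Semiring.Exp semiring using (^-homo-*; ^-congˡ)
  open import Algebra.Properties.CommutativeSemiring.Exp commutativeSemiring using (^-distrib-*)
  import Algebra.Properties.CommutativeSemigroup *-commutativeSemigroup as ×
  import Algebra.Properties.Ring ring as Ringₚ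
  open import Relation.Binary.Reasoning.Setoid setoid

  1^≈1 : ∀ e → 1# ^ e ≈ 1#
  1^≈1 zero    = refl
  1^≈1 (suc e) = trans (*-identityˡ _) (1^≈1 e)

  evalMono : ∀ {m} → (Fin m → Carrier) → Vec ℕ m → Carrier
  evalMono χ []      = 1#
  evalMono χ (e ∷ v) = χ Fin.zero ^ e * evalMono (χ ∘ Fin.suc) v

  evalMono-zipWith : ∀ {m} χ (u v : Vec ℕ m) → evalMono χ (Vec.zipWith ℕ._+_ u v) ≈ evalMono χ u * evalMono χ v
  evalMono-zipWith χ []      []      = sym (*-identityˡ 1#)
  evalMono-zipWith χ (d ∷ u) (e ∷ v) = begin
    χ Fin.zero ^ (d ℕ.+ e) * evalMono _ (Vec.zipWith ℕ._+_ u v)             ≈⟨ *-cong (^-homo-* _ d e) (evalMono-zipWith (χ ∘ Fin.suc) u v) ⟩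
    (χ Fin.zero ^ d * χ Fin.zero ^ e) * (evalMono _ u * evalMono _ v)      ≈⟨ ×.interchange _ _ _ _ ⟩
    (χ Fin.zero ^ d * evalMono _ u) * (χ Fin.zero ^ e * evalMono _ v)      ∎

  evalMono-ones : ∀ {m} χ (v : Vec ℕ m) → (∀ k → χ k ^ lookup v k ≈ 1#) → evalMono χ v ≈ 1#
  evalMono-ones χ []      _   = refl
  evalMono-ones χ (e ∷ v) one = trans (*-cong (one Fin.zero) (evalMono-ones (χ ∘ Fin.suc) v (one ∘ Fin.suc))) (*-identityˡ 1#)

  evalMono-at : ∀ {m} χ (v : Vec ℕ m) l → (∀ k → k ≢ l → χ k ^ lookup v k ≈ 1#) → evalMono χ v ≈ χ l ^ lookup v l
  evalMono-at χ (e ∷ v) Fin.zero    one = trans (*-congˡ (evalMono-ones (χ ∘ Fin.suc) v (λ k → one (Fin.suc k) λ ()))) (*-identityʳ _)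
  evalMono-at χ (e ∷ v) (Fin.suc l) one = trans
    (*-cong (one Fin.zero λ ()) (evalMono-at (χ ∘ Fin.suc) v l (λ k k≢l → one (Fin.suc k) (k≢l ∘ Finₚ.suc-injective))))
    (*-identityˡ _)

  eval : (Fin n → Carrier) → Pol → Carrier
  eval χ = pairing (evalMono χ)

  eval-*ₚ : ∀ χ p q → eval χ (p *ₚ q) ≈ eval χ p * eval χ q
  eval-*ₚ χ p q = begin
    eval χ (p *ₚ q)                                           ≈⟨ pairing-*ₚ _ p q ⟩
    pairing (λ u → pairing (λ v → evalMono χ (u ·ᵐ v)) q) p
      ≈⟨ pairing-cong p (λ {t} _ → pairing-cong q (λ {t′} _ → evalMono-zipWith χ (proj₂ t) (proj₂ t′))) ⟩
    pairing (λ u → pairing (λ v → evalMono χ u * evalMono χ v) q) p ≈⟨ pairing-cong p (λ {t} _ → pairing-*ˡ (evalMono χ (proj₂ t)) _ q) ⟩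
    pairing (λ u → evalMono χ u * eval χ q) p                 ≈⟨ pairing-cong p (λ _ → *-comm _ _) ⟩
    pairing (λ u → eval χ q * evalMono χ u) p                 ≈⟨ pairing-*ˡ (eval χ q) _ p ⟩
    eval χ q * eval χ p                                       ≈⟨ *-comm _ _ ⟩
    eval χ p * eval χ q                                       ∎

  eval-1ₚ : ∀ χ → eval χ 1ₚ ≈ 1#
  eval-1ₚ χ = trans (+-identityʳ _) (trans (*-identityˡ _) (evalMono-ones χ one (λ k → reflexive (≡.cong (χ k ^_) (lookup-one k)))))

  eval-^ₚ : ∀ χ p e → eval χ (p ^ₚ e) ≈ eval χ p ^ e
  eval-^ₚ χ p zero    = eval-1ₚ χ
  eval-^ₚ χ p (suc e) = trans (eval-*ₚ χ p _) (*-congˡ (eval-^ₚ χ p e))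

  eval-prodₚ : ∀ χ {m} (f : Fin m → Pol) (e : Vec ℕ m) →
               eval χ (prodₚ (tabulate (λ k → f k ^ₚ lookup e k))) ≈ evalMono (λ k → eval χ (f k)) e
  eval-prodₚ χ f []      = eval-1ₚ χ
  eval-prodₚ χ f (d ∷ e) = trans (eval-*ₚ χ (f Fin.zero ^ₚ d) _) (*-cong (eval-^ₚ χ (f Fin.zero) d) (eval-prodₚ χ (f ∘ Fin.suc) e))

  eval-var : ∀ χ k → eval χ (var k) ≈ χ k
  eval-var χ k = begin
    1# * evalMono χ (unitᵐ k) + 0#  ≈⟨ trans (+-identityʳ _) (*-identityˡ _) ⟩
    evalMono χ (unitᵐ k)
      ≈⟨ evalMono-at χ (unitᵐ k) k (λ l k≢l → reflexive (≡.cong (χ l ^_) (lookup-unitᵐ-other (k≢l ∘ ≡.sym)))) ⟩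
    χ k ^ lookup (unitᵐ k) k        ≈⟨ reflexive (≡.cong (χ k ^_) (lookup-unitᵐ-self k)) ⟩
    χ k ^ 1                         ≈⟨ *-identityʳ _ ⟩
    χ k                             ∎

  pointAt : Fin n → Carrier → Fin n → Carrier
  pointAt l a k = if does (k ≟ l) then a else 1#

  pointAt-self : ∀ l a → pointAt l a l ≡ a
  pointAt-self l a rewrite dec-true (l ≟ l) ≡.refl = ≡.refl

  pointAt-other : ∀ {l k} a → k ≢ l → pointAt l a k ≡ 1#
  pointAt-other {l} {k} a k≢l rewrite dec-false (k ≟ l) k≢l = ≡.refl

  evalMono-pointAt : ∀ l a v → evalMono (pointAt l a) v ≈ a ^ lookup v l
  evalMono-pointAt l a v = trans
    (evalMono-at (pointAt l a) v l (λ k k≢l → trans (^-congˡ (lookup v k) (reflexive (pointAt-other a k≢l))) (1^≈1 (lookup v k))))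
    (reflexive (≡.cong (_^ lookup v l) (pointAt-self l a)))

  δ≈0^ : ∀ {m v} l → lookup m l ≡ 0 → (lookup v l ≡ 0 → v ≡ m) → δ m v ≈ 0# ^ lookup v l
  δ≈0^ {m} {v} l mₗ≡0 unique with lookup v l in vₗ≡
  ... | zero  = δ-≡ {m} {v} (unique ≡.refl)
  ... | suc e = trans (δ-≢ {m} {v} (λ v≡m → ℕₚ.1+n≢0 (≡.trans (≡.sym vₗ≡) (≡.trans (≡.cong (λ x → lookup x l) v≡m) mₗ≡0))))
                      (sym (zeroˡ _))

  sign-cancel : ∀ e {x} → (- 1#) ^ e * x ≈ 0# → x ≈ 0#
  sign-cancel e {x} ±x≈0 = begin
    x                               ≈⟨ *-identityˡ x ⟨
    1# * x                          ≈⟨ *-congʳ ±1² ⟨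
    ((- 1#) ^ e * (- 1#) ^ e) * x   ≈⟨ *-assoc _ _ x ⟩
    (- 1#) ^ e * ((- 1#) ^ e * x)   ≈⟨ *-congˡ ±x≈0 ⟩
    (- 1#) ^ e * 0#                 ≈⟨ zeroʳ _ ⟩
    0#                              ∎
    where
    ±1² : (- 1#) ^ e * (- 1#) ^ e ≈ 1#
    ±1² = trans (sym (^-distrib-* (- 1#) (- 1#) e))
                (trans (^-congˡ e (trans (Ringₚ.-1*x≈-x (- 1#)) (Ringₚ.-‿involutive 1#))) (1^≈1 e))

module BlockSums {c ℓ} (K : Field c ℓ) {n : ℕ} (i j : Fin n) (i≢j : i ≢ j) where
  open Field K
  open Poly K n
  open Pairing K n
  open Block i j i≢j
  open import Algebra.Properties.CommutativeMonoid.Sum +-commutativeMonoid using (sum; sum-cong-≋)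
  open SumProperties +-commutativeMonoid
  open import Relation.Binary.Reasoning.Setoid setoid

  blockSum : Mono n → (Mono n → Carrier) → Carrier
  blockSum m h = sum {suc (ijDeg m)} (λ p → h (blockMono m (toℕ p)))

  private
    toℕ≤ijDeg : ∀ m (p : Fin (suc (ijDeg m))) → toℕ p ℕ.≤ ijDeg m
    toℕ≤ijDeg m p = ℕₚ.≤-pred (Finₚ.toℕ<n p)

  blockSum-zero : ∀ m h → (∀ x → SameBlock m x → h x ≈ 0#) → blockSum m h ≈ 0#
  blockSum-zero m h h≈0 = ∑-zero (λ p → h (blockMono m (toℕ p))) (λ p → h≈0 _ (SameBlock-blockMono m (toℕ≤ijDeg m p)))

  blockSum-single : ∀ m h {v} → SameBlock m v → (∀ x → SameBlock m x → x ≢ v → h x ≈ 0#) → blockSum m h ≈ h v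
  blockSum-single m h {v} b h≈0 = begin
    blockSum m h                  ≈⟨ ∑-single (λ p → h (blockMono m (toℕ p))) q others ⟩
    h (blockMono m (toℕ q))       ≡⟨ ≡.cong (h ∘ blockMono m) (Finₚ.toℕ-fromℕ< _) ⟩
    h (blockMono m (lookup v i))  ≡⟨ ≡.cong h (≡-blockMono b) ⟨
    h v                           ∎
    where
    q : Fin (suc (ijDeg m))
    q = fromℕ< (s≤s (lookupⁱ≤ijDeg b))
    others : ∀ p → p ≢ q → h (blockMono m (toℕ p)) ≈ 0#
    others p p≢q = h≈0 _ (SameBlock-blockMono m (toℕ≤ijDeg m p)) λ eq → p≢q (Finₚ.toℕ-injective
      (≡.trans (≡.sym (blockMonoⁱ m (toℕ p))) (≡.trans (≡.cong (λ x → lookup x i) eq) (≡.sym (Finₚ.toℕ-fromℕ< _)))))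

  pairing-blockSupported : ∀ m {w} → (∀ v → ¬ SameBlock m v → w v ≈ 0#) → ∀ P →
                           pairing w P ≈ blockSum m (λ x → w x * coeff P x)
  pairing-blockSupported m {w} w≈0 P = begin
    pairing w P                                        ≈⟨ pairing-cong P (λ {t} _ → restrict (proj₂ t)) ⟩
    pairing (λ v → blockSum m (λ x → w x * δ x v)) P   ≈⟨ pairing-∑ (λ p v → w (member p) * δ (member p) v) P ⟩
    blockSum m (λ x → pairing (λ v → w x * δ x v) P)   ≈⟨ sum-cong-≋ (λ p → pairing-*ˡ (w (member p)) (δ (member p)) P) ⟩
    blockSum m (λ x → w x * pairing (δ x) P)           ≈⟨ sum-cong-≋ (λ p → *-congˡ {w (member p)} (sym (coeff≈pairing-δ P (member p)))) ⟩
    blockSum m (λ x → w x * coeff P x)                 ∎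
    where
    member : Fin (suc (ijDeg m)) → Mono n
    member p = blockMono m (toℕ p)
    restrict : ∀ v → w v ≈ blockSum m (λ x → w x * δ x v)
    restrict v with sameBlock? m v
    ... | yes b = sym (trans
      (blockSum-single m (λ x → w x * δ x v) b (λ x _ x≢v → trans (*-congˡ (δ-≢ {x} {v} (x≢v ∘ ≡.sym))) (zeroʳ (w x))))
      (trans (*-congˡ (δ-≡ {v} ≡.refl)) (*-identityʳ (w v))))
    ... | no ¬b = trans (w≈0 v ¬b) (sym
      (blockSum-zero m (λ x → w x * δ x v) (λ x b → trans (*-congˡ (δ-≢ {x} {v} λ { ≡.refl → ¬b b })) (zeroʳ (w x)))))

-- The substitution φ_ij
module Substitution {c ℓ} (K : Field c ℓ) {n : ℕ} (i j : Fin n) (i≢j : i ≢ j) where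
  open Field K
  open Poly K n
  open Pairing K n
  open Evaluation K n
  open Block i j i≢j

  σ : Fin n → Pol
  σ k = if does (k ≟ j) then var i +ₚ var j else var k

  φᵐ : Mono n → Pol
  φᵐ u = prodₚ (tabulate (λ k → σ k ^ₚ lookup u k))

  pairing-φ : ∀ w p → pairing w (φ i j p) ≈ pairing (λ u → pairing w (φᵐ u)) p
  pairing-φ w []            = refl
  pairing-φ w ((a , u) ∷ p) = trans (pairing-++ w (((a , one) ∷ []) *ₚ φᵐ u) (φ i j p)) (+-cong (pairing-scale w a (φᵐ u)) (pairing-φ w p))

  eval-σ : ∀ χ {a} k → (k ≡ j → χ i + χ j ≈ a) → (k ≢ j → χ k ≈ a) → eval χ (σ k) ≈ a
  eval-σ χ k k≡j⇒ k≢j⇒ with k ≟ j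
  ... | yes k≡j = trans (pairing-++ (evalMono χ) (var i) (var j)) (trans (+-cong (eval-var χ i) (eval-var χ j)) (k≡j⇒ k≡j))
  ... | no k≢j  = trans (eval-var χ k) (k≢j⇒ k≢j)

  eval-φᵐ : ∀ χ u → eval χ (φᵐ u) ≈ evalMono (λ k → eval χ (σ k)) u
  eval-φᵐ χ = eval-prodₚ χ σ

  -- Monomials of φᵐ u are graded by any additive L on which each σ k is graded like x_k.
  module Graded (L : Mono n → ℕ) (L-·ᵐ : ∀ u v → L (u ·ᵐ v) ≡ L u ℕ.+ L v) (L-one : L one ≡ 0)
                (_R_ : ℕ → ℕ → Set) (R-refl : ∀ {a} → a R a) (R-+ : ∀ {a b d e} → a R b → d R e → (a ℕ.+ d) R (b ℕ.+ e)) where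

    private
      _∼_ : Mono n → ℕ → Set
      t ∼ a = L t R a

    EveryMono-1ₚ : EveryMono (_∼ 0) 1ₚ
    EveryMono-1ₚ (here ≡.refl) = ≡.subst (_R 0) (≡.sym L-one) R-refl

    EveryMono-*ₚ-∼ : ∀ {a b} p q → EveryMono (_∼ a) p → EveryMono (_∼ b) q → EveryMono (_∼ (a ℕ.+ b)) (p *ₚ q)
    EveryMono-*ₚ-∼ {a} {b} p q Pp Qq = EveryMono-*ₚ {R = _∼ (a ℕ.+ b)} p q Pp Qq
      (λ {u} {v} u∼a v∼b → ≡.subst (_R (a ℕ.+ b)) (≡.sym (L-·ᵐ u v)) (R-+ u∼a v∼b))

    EveryMono-^ₚ : ∀ {a} p e → EveryMono (_∼ a) p → EveryMono (_∼ (e ℕ.* a)) (p ^ₚ e)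
    EveryMono-^ₚ p zero    Pp = EveryMono-1ₚ
    EveryMono-^ₚ p (suc e) Pp = EveryMono-*ₚ-∼ p (p ^ₚ e) Pp (EveryMono-^ₚ p e Pp)

    EveryMono-prodₚ : ∀ {m} (f : Fin m → Pol) (a : Fin m → ℕ) → (∀ k → EveryMono (_∼ a k) (f k)) →
                      ∀ e → EveryMono (_∼ dot a e) (prodₚ (tabulate (λ k → f k ^ₚ lookup e k)))
    EveryMono-prodₚ f a Pf []      = EveryMono-1ₚ
    EveryMono-prodₚ f a Pf (d ∷ e) = EveryMono-*ₚ-∼ (f Fin.zero ^ₚ d) _ (EveryMono-^ₚ (f Fin.zero) d (Pf Fin.zero))
                                       (EveryMono-prodₚ (f ∘ Fin.suc) (a ∘ Fin.suc) (Pf ∘ Fin.suc) e)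

    EveryMono-σ : L (unitᵐ i) R L (unitᵐ j) → ∀ k → EveryMono (_∼ L (unitᵐ k)) (σ k)
    EveryMono-σ iRj k with k ≟ j
    ... | yes ≡.refl = λ { (here ≡.refl) → iRj ; (there (here ≡.refl)) → R-refl }
    ... | no _ = λ { (here ≡.refl) → R-refl }

    EveryMono-φᵐ : L (unitᵐ i) R L (unitᵐ j) → ∀ u → EveryMono (_∼ dot (L ∘ unitᵐ) u) (φᵐ u)
    EveryMono-φᵐ iRj = EveryMono-prodₚ σ (L ∘ unitᵐ) (EveryMono-σ iRj)

  φᵐ-monos : ∀ u → EveryMono (λ t → SameBlock u t × lookup t j ℕ.≤ lookup u j) (φᵐ u)
  φᵐ-monos u t∈ = sameBlock (λ l l≢i l≢j → coord l l≢i l≢j t∈) (ijDeg-φᵐ t∈) , lookupʲ-φᵐ t∈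
    where
    coord : ∀ l → l ≢ i → l ≢ j → EveryMono (λ t → lookup t l ≡ lookup u l) (φᵐ u)
    coord l l≢i l≢j t∈ = ≡.trans (G.EveryMono-φᵐ i≈j u t∈) (dot-unitᵐ l u)
      where
      module G = Graded (λ t → lookup t l) (λ u v → lookup-·ᵐ u v l) (lookup-one l) _≡_ ≡.refl (≡.cong₂ ℕ._+_)
      i≈j : lookup (unitᵐ i) l ≡ lookup (unitᵐ j) l
      i≈j = ≡.trans (lookup-unitᵐ-other (l≢i ∘ ≡.sym)) (≡.sym (lookup-unitᵐ-other (l≢j ∘ ≡.sym)))
    ijDeg-φᵐ : EveryMono (λ t → ijDeg t ≡ ijDeg u) (φᵐ u)
    ijDeg-φᵐ t∈ = ≡.trans (G.EveryMono-φᵐ i≈j u t∈)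
      (≡.trans (dot-+ (λ k → lookup (unitᵐ k) i) (λ k → lookup (unitᵐ k) j) u) (≡.cong₂ ℕ._+_ (dot-unitᵐ i u) (dot-unitᵐ j u)))
      where
      ijDeg-·ᵐ : ∀ u v → ijDeg (u ·ᵐ v) ≡ ijDeg u ℕ.+ ijDeg v
      ijDeg-·ᵐ u v rewrite lookup-·ᵐ u v i | lookup-·ᵐ u v j = ℕ+.interchange (lookup u i) (lookup v i) _ _
      module G = Graded ijDeg ijDeg-·ᵐ (≡.cong₂ ℕ._+_ (lookup-one i) (lookup-one j)) _≡_ ≡.refl (≡.cong₂ ℕ._+_)
      i≈j : ijDeg (unitᵐ i) ≡ ijDeg (unitᵐ j)
      i≈j rewrite lookup-unitᵐ-self i | lookup-unitᵐ-self j | lookup-unitᵐ-other i≢j | lookup-unitᵐ-other (≡.≢-sym i≢j) = ≡.refl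
    lookupʲ-φᵐ : EveryMono (λ t → lookup t j ℕ.≤ lookup u j) (φᵐ u)
    lookupʲ-φᵐ t∈ = ℕₚ.≤-trans (G.EveryMono-φᵐ i≤j u t∈) (ℕₚ.≤-reflexive (dot-unitᵐ j u))
      where
      module G = Graded (λ t → lookup t j) (λ u v → lookup-·ᵐ u v j) (lookup-one j) ℕ._≤_ ℕₚ.≤-refl ℕₚ.+-mono-≤
      i≤j : lookup (unitᵐ i) j ℕ.≤ lookup (unitᵐ j) j
      i≤j rewrite lookup-unitᵐ-other i≢j = z≤n

module ImageCoefficients {c ℓ} (K : Field c ℓ) {n : ℕ} (i j : Fin n) (i≢j : i ≢ j) where
  open Field K
  open Poly K n
  open Pairing K n
  open Evaluation K n
  open Block i j i≢j
  open BlockSums K i j i≢j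
  open Substitution K i j i≢j
  open import Algebra.Properties.CommutativeMonoid.Sum +-commutativeMonoid using (sum-cong-≋)
  open import Algebra.Properties.Semiring.Exp semiring using (^-congˡ)
  open import Relation.Binary.Reasoning.Setoid setoid

  coeff-φᵐ-outside : ∀ u m → ¬ SameBlock u m → coeff (φᵐ u) m ≈ 0#
  coeff-φᵐ-outside u m ¬b = coeff-zero (φᵐ u) m (λ t∈ t≡m → ¬b (≡.subst (SameBlock u) t≡m (proj₁ (φᵐ-monos u t∈))))

  coeff-φᵐ-aboveʲ : ∀ u m → lookup u j ℕ.< lookup m j → coeff (φᵐ u) m ≈ 0#
  coeff-φᵐ-aboveʲ u m uⱼ<mⱼ = coeff-zero (φᵐ u) m
    (λ t∈ t≡m → ℕₚ.<⇒≱ uⱼ<mⱼ (≡.subst (λ t → lookup t j ℕ.≤ lookup u j) t≡m (proj₂ (φᵐ-monos u t∈))))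

  -- Evaluating at a point with a single zero coordinate detects the block monomial with that exponent zero.
  coeff-φᵐ≈eval : ∀ u m l → lookup m l ≡ 0 → (∀ {t} → SameBlock u t → lookup t l ≡ 0 → t ≡ m) →
                  coeff (φᵐ u) m ≈ eval (pointAt l 0#) (φᵐ u)
  coeff-φᵐ≈eval u m l mₗ≡0 unique = trans (coeff≈pairing-δ (φᵐ u) m) (pairing-cong (φᵐ u)
    (λ {t} t∈ → trans (δ≈0^ l mₗ≡0 (unique (proj₁ (φᵐ-monos u t∈)))) (sym (evalMono-pointAt l 0# (proj₂ t)))))

  coeff-φᵐ-bottom : ∀ {u m} → SameBlock u m → lookup m j ≡ 0 → coeff (φᵐ u) m ≈ 1#
  coeff-φᵐ-bottom {u} {m} b mⱼ≡0 = begin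
    coeff (φᵐ u) m                  ≈⟨ coeff-φᵐ≈eval u m j mⱼ≡0 unique ⟩
    eval χ (φᵐ u)                   ≈⟨ eval-φᵐ χ u ⟩
    evalMono (λ k → eval χ (σ k)) u ≈⟨ evalMono-ones _ u (λ k → trans (^-congˡ (lookup u k) (σ≈1 k)) (1^≈1 (lookup u k))) ⟩
    1#                              ∎
    where
    χ = pointAt j 0#
    unique : ∀ {t} → SameBlock u t → lookup t j ≡ 0 → t ≡ m
    unique b′ tⱼ≡0 = SameBlock-≡ʲ (SameBlock-trans (SameBlock-sym b) b′) (≡.trans tⱼ≡0 (≡.sym mⱼ≡0))
    σ≈1 : ∀ k → eval χ (σ k) ≈ 1#
    σ≈1 k = eval-σ χ k (λ _ → trans (+-cong (reflexive (pointAt-other 0# i≢j)) (reflexive (pointAt-self j 0#))) (+-identityʳ 1#))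
                       (reflexive ∘ pointAt-other 0#)

  coeff-φᵐ-self : ∀ u → lookup u i ≡ 0 → coeff (φᵐ u) u ≈ 1#
  coeff-φᵐ-self u uᵢ≡0 = begin
    coeff (φᵐ u) u                  ≈⟨ coeff-φᵐ≈eval u u i uᵢ≡0 (λ b tᵢ≡0 → SameBlock-≡ⁱ b (≡.trans tᵢ≡0 (≡.sym uᵢ≡0))) ⟩
    eval χ (φᵐ u)                   ≈⟨ eval-φᵐ χ u ⟩
    evalMono (λ k → eval χ (σ k)) u ≈⟨ evalMono-at _ u i (λ k k≢i → trans (^-congˡ (lookup u k) (σ≈1 k k≢i)) (1^≈1 (lookup u k))) ⟩
    eval χ (σ i) ^ lookup u i       ≡⟨ ≡.cong (eval χ (σ i) ^_) uᵢ≡0 ⟩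
    1#                              ∎
    where
    χ = pointAt i 0#
    σ≈1 : ∀ k → k ≢ i → eval χ (σ k) ≈ 1#
    σ≈1 k k≢i = eval-σ χ k (λ _ → trans (+-cong (reflexive (pointAt-self i 0#)) (reflexive (pointAt-other 0# (≡.≢-sym i≢j)))) (+-identityˡ 1#))
                           (λ _ → reflexive (pointAt-other 0# k≢i))

  coeff-φ≈pairing : ∀ f m → coeff (φ i j f) m ≈ pairing (λ u → coeff (φᵐ u) m) f
  coeff-φ≈pairing f m = begin
    coeff (φ i j f) m                        ≈⟨ coeff≈pairing-δ (φ i j f) m ⟩
    pairing (δ m) (φ i j f)                  ≈⟨ pairing-φ (δ m) f ⟩
    pairing (λ u → pairing (δ m) (φᵐ u)) f   ≈⟨ pairing-cong f (λ {t} _ → coeff≈pairing-δ (φᵐ (proj₂ t)) m) ⟨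
    pairing (λ u → coeff (φᵐ u) m) f         ∎

  coeff-φ : ∀ f m → coeff (φ i j f) m ≈ blockSum m (λ x → coeff (φᵐ x) m * coeff f x)
  coeff-φ f m = trans (coeff-φ≈pairing f m) (pairing-blockSupported m (λ u ¬b → coeff-φᵐ-outside u m (¬b ∘ SameBlock-sym)) f)

  φ-mono : ∀ x → φ i j (mono x) ≋ φᵐ x
  φ-mono x m = trans (coeff-φ≈pairing (mono x) m) (pairing-mono (λ u → coeff (φᵐ u) m) x)

  coeff-φ-zero : ∀ S m → EveryMono (λ u → SameBlock m u → lookup u j ℕ.< lookup m j) S → coeff (φ i j S) m ≈ 0#
  coeff-φ-zero S m below = trans (coeff-φ≈pairing S m) (pairing-zero S (λ {t} t∈ → vanish (proj₂ t) (below t∈)))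
    where
    vanish : ∀ u → (SameBlock m u → lookup u j ℕ.< lookup m j) → coeff (φᵐ u) m ≈ 0#
    vanish u uⱼ<mⱼ with sameBlock? u m
    ... | no ¬b = coeff-φᵐ-outside u m ¬b
    ... | yes b = coeff-φᵐ-aboveʲ u m (uⱼ<mⱼ (SameBlock-sym b))

  φ-cong : ∀ {f g} → f ≋ g → φ i j f ≋ φ i j g
  φ-cong {f} {g} f≋g m = trans (coeff-φ f m) (trans (sum-cong-≋ coeffs≈) (sym (coeff-φ g m)))
    where
    member : Fin (suc (ijDeg m)) → Mono n
    member p = blockMono m (toℕ p)
    coeffs≈ : ∀ p → coeff (φᵐ (member p)) m * coeff f (member p) ≈ coeff (φᵐ (member p)) m * coeff g (member p)
    coeffs≈ p = *-congˡ (f≋g (member p))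

  alternating : Mono n → Mono n → Carrier
  alternating m v with sameBlock? m v
  ... | yes _ = (- 1#) ^ lookup v j
  ... | no _  = 0#

  alternating-in : ∀ {m v} → SameBlock m v → alternating m v ≈ (- 1#) ^ lookup v j
  alternating-in {m} {v} b with sameBlock? m v
  ... | yes _ = refl
  ... | no ¬b = ⊥-elim (¬b b)

  alternating-out : ∀ {m v} → ¬ SameBlock m v → alternating m v ≈ 0#
  alternating-out {m} {v} ¬b with sameBlock? m v
  ... | yes b = ⊥-elim (¬b b)
  ... | no _  = refl

  -- At x_i = 1, x_j = -1 the factor x_i + x_j of φ_ij(x_j) vanishes.
  pairing-alternating-φᵐ : ∀ m u → (SameBlock m u → 0 ℕ.< lookup u j) → pairing (alternating m) (φᵐ u) ≈ 0#
  pairing-alternating-φᵐ m u uⱼ>0 with sameBlock? m u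
  ... | no ¬b = pairing-zero (φᵐ u) (λ t∈ → alternating-out (λ b → ¬b (SameBlock-trans b (SameBlock-sym (proj₁ (φᵐ-monos u t∈))))))
  ... | yes b with lookup u j in uⱼ≡ | uⱼ>0 b
  ...   | suc e | _ = begin
    pairing (alternating m) (φᵐ u)   ≈⟨ pairing-cong (φᵐ u) (λ {t} t∈ → signs (proj₂ t) (proj₁ (φᵐ-monos u t∈))) ⟩
    eval χ (φᵐ u)                    ≈⟨ eval-φᵐ χ u ⟩
    evalMono (λ k → eval χ (σ k)) u  ≈⟨ evalMono-at _ u j (λ k k≢j → trans (^-congˡ (lookup u k) (σ≈1 k k≢j)) (1^≈1 (lookup u k))) ⟩
    eval χ (σ j) ^ lookup u j        ≡⟨ ≡.cong (eval χ (σ j) ^_) uⱼ≡ ⟩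
    eval χ (σ j) * eval χ (σ j) ^ e  ≈⟨ *-congʳ σⱼ≈0 ⟩
    0# * eval χ (σ j) ^ e            ≈⟨ zeroˡ _ ⟩
    0#                               ∎
    where
    χ = pointAt j (- 1#)
    signs : ∀ t → SameBlock u t → alternating m t ≈ evalMono χ t
    signs t b′ = trans (alternating-in (SameBlock-trans b b′)) (sym (evalMono-pointAt j (- 1#) t))
    σ≈1 : ∀ k → k ≢ j → eval χ (σ k) ≈ 1#
    σ≈1 k k≢j = eval-σ χ k (⊥-elim ∘ k≢j) (λ _ → reflexive (pointAt-other (- 1#) k≢j))
    σⱼ≈0 : eval χ (σ j) ≈ 0#
    σⱼ≈0 = eval-σ χ j (λ _ → trans (+-cong (reflexive (pointAt-other (- 1#) i≢j)) (reflexive (pointAt-self j (- 1#)))) (-‿inverseʳ 1#))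
                      (λ j≢j → ⊥-elim (j≢j ≡.refl))

  module _ (i<j : toℕ i ℕ.< toℕ j) where

    φᵐ-leading : ∀ {u m} → SameBlock u m → lookup m j ≡ 0 → IsLeadingMono (φᵐ u) m
    φᵐ-leading {u} {m} b mⱼ≡0 = (λ c≈0 → 1≉0 (trans (sym (coeff-φᵐ-bottom b mⱼ≡0)) c≈0)) , above
      where
      above : ∀ m′ → m <drl m′ → coeff (φᵐ u) m′ ≈ 0#
      above m′ m<m′ with sameBlock? u m′
      ... | no ¬b′ = coeff-φᵐ-outside u m′ ¬b′
      ... | yes b′ = ⊥-elim (ℕₚ.n≮0 (≡.subst (lookup m′ j ℕ.<_) mⱼ≡0
                       (SameBlock-<drl⇒ i<j (SameBlock-trans (SameBlock-sym b) b′) m<m′)))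

    -- Pairing φ(S) with the alternating functional of the block of m isolates ±(coefficient at m),
    -- since the other block members lie above m; but it kills every φᵐ u with u_j > 0.
    leading-φ-alternating : ∀ S {m} → lookup m i ≡ 0 → EveryMono (λ u → SameBlock m u → 0 ℕ.< lookup u j) S →
                            ¬ IsLeadingMono (φ i j S) m
    leading-φ-alternating S {m} mᵢ≡0 positive (c≉0 , above) = c≉0 (sign-cancel (lookup m j) (begin
      (- 1#) ^ lookup m j * coeff (φ i j S) m                ≈⟨ *-congʳ (alternating-in SameBlock-refl) ⟨
      alternating m m * coeff (φ i j S) m                    ≈⟨ blockSum-single m _ SameBlock-refl higher ⟨
      blockSum m (λ x → alternating m x * coeff (φ i j S) x) ≈⟨ pairing-blockSupported m (λ _ → alternating-out) (φ i j S) ⟨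
      pairing (alternating m) (φ i j S)                      ≈⟨ pairing-φ (alternating m) S ⟩
      pairing (λ u → pairing (alternating m) (φᵐ u)) S       ≈⟨ pairing-zero S (λ t∈ → pairing-alternating-φᵐ m _ (positive t∈)) ⟩
      0#                                                     ∎))
      where
      higher : ∀ x → SameBlock m x → x ≢ m → alternating m x * coeff (φ i j S) x ≈ 0#
      higher x b x≢m = trans (*-congˡ (above x (SameBlock-<drl⇐ i<j b (SameBlock-belowʲ mᵢ≡0 b x≢m)))) (zeroʳ _)

-- Shifting
module Shifting {n : ℕ} (Γ : SimplicialComplex n) (i j : Fin n) (i≢j : i ≢ j) where
  open SimplicialComplex Γ

  C-cases : ∀ F → (i ∈ F × j ∉ F × ¬ Face (exchange i j F) × C Γ i j F ≡ exchange i j F)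
                ⊎ (¬ (i ∈ F × j ∉ F × ¬ Face (exchange i j F)) × C Γ i j F ≡ F)
  C-cases F with (i Subsetₚ.∈? F) ×-dec (¬? (j Subsetₚ.∈? F) ×-dec ¬? (face? (exchange i j F)))
  ... | yes (i∈F , j∉F , ¬face) = inj₁ (i∈F , j∉F , ¬face , ≡.refl)
  ... | no ¬swap                 = inj₂ (¬swap , ≡.refl)

  Shift⁻ : ∀ {G} → Shift Γ i j G →
           (Face G × (i ∈ G → j ∉ G → Face (exchange i j G))) ⊎ (j ∈ G × i ∉ G × Face (exchange j i G))
  Shift⁻ (F , face , CF≡G) with C-cases F
  ... | inj₁ (i∈F , _ , _ , CF≡) rewrite ≡.sym CF≡G | CF≡ =
    inj₂ (∈-exchange⁺ (inj₂ ≡.refl) , ∉-exchange i≢j , down-closed (exchange-exchange-⊆ i∈F) face)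
  ... | inj₂ (¬swap , CF≡F) rewrite ≡.sym CF≡G | CF≡F = inj₁ (face , swapFace)
    where
    swapFace : i ∈ F → j ∉ F → Face (exchange i j F)
    swapFace i∈F j∉F with face? (exchange i j F)
    ... | yes face′ = face′
    ... | no ¬face  = ⊥-elim (¬swap (i∈F , j∉F , ¬face))

  Shift⁺-face : ∀ {G} → Face G → (i ∈ G → j ∉ G → Face (exchange i j G)) → Shift Γ i j G
  Shift⁺-face {G} face swapFace with C-cases G
  ... | inj₁ (i∈G , j∉G , ¬face , _) = ⊥-elim (¬face (swapFace i∈G j∉G))
  ... | inj₂ (_ , CG≡G)               = G , face , CG≡G

  Shift⁺-back : ∀ {G} → j ∈ G → i ∉ G → Face (exchange j i G) → Shift Γ i j G
  Shift⁺-back {G} j∈G i∉G face with face? G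
  ... | yes faceG = Shift⁺-face faceG (λ i∈G → ⊥-elim (i∉G i∈G))
  ... | no ¬faceG with C-cases (exchange j i G)
  ...   | inj₁ (_ , _ , _ , C≡) = exchange j i G , face , ≡.trans C≡ (exchange-exchange j∈G i∉G)
  ...   | inj₂ (¬swap , _)      =
    ⊥-elim (¬swap (∈-exchange⁺ (inj₂ ≡.refl) , ∉-exchange (≡.≢-sym i≢j) , ¬faceG ∘ ≡.subst Face (exchange-exchange j∈G i∉G)))

module MinimalNonFaces {n : ℕ} (Γ : SimplicialComplex n) where
  open SimplicialComplex Γ

  shrink : (ks : List (Fin n)) (H : Subset n) → ¬ Face H →
           Σ (Subset n) λ M → M ⊆ H × ¬ Face M × All (λ k → k ∉ M ⊎ Face (M - k)) ks
  shrink []       H ¬face = H , id , ¬face , []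
  shrink (k ∷ ks) H ¬face with face? (H - k)
  ... | yes face-k = let M , M⊆H , ¬faceM , done = shrink ks H ¬face in
    M , M⊆H , ¬faceM , inj₂ (down-closed (λ x∈ → Subsetₚ.x∈p∧x≢y⇒x∈p-y (M⊆H (Subsetₚ.p─q⊆p M ⁅ k ⁆ x∈)) (x∈p-y⇒x≢y x∈)) face-k)
                     ∷ done
  ... | no ¬face-k = let M , M⊆H-k , ¬faceM , done = shrink ks (H - k) ¬face-k in
    M , Subsetₚ.p─q⊆p H ⁅ k ⁆ ∘ M⊆H-k , ¬faceM , inj₁ (x∉p-x ∘ M⊆H-k) ∷ done

  minimalNonFace : ∀ {H} → ¬ Face H → Σ (Subset n) λ M → M ⊆ H × ¬ Face M × (∀ {k} → k ∈ M → Face (M - k))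
  minimalNonFace {H} ¬face with shrink (List.allFin n) H ¬face
  ... | M , M⊆H , ¬faceM , done = M , M⊆H , ¬faceM , λ {k} k∈M → [ (λ k∉M → ⊥-elim (k∉M k∈M)) , id ]′ (All.lookup done (∈-allFin k))

-- Monomial ideals and Stanley–Reisner ideals
module Ideals {c ℓ} (K : Field c ℓ) (n : ℕ) where
  open Field K
  open Poly K n
  open Pairing K n
  open import Relation.Binary.Reasoning.Setoid setoid

  combination : List (Pol × Pol) → Pol
  combination hs = sumₚ (List.map (λ { (h , g) → h *ₚ g }) hs)

  coeff-++ : ∀ p q m → coeff (p ++ q) m ≈ coeff p m + coeff q m
  coeff-++ p q m = trans (coeff≈pairing-δ (p ++ q) m)
    (trans (pairing-++ (δ m) p q) (sym (+-cong (coeff≈pairing-δ p m) (coeff≈pairing-δ q m))))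

  ⟨⟩-mono : ∀ {G : PSet} {x} → G (mono x) → ⟨ G ⟩ (mono x)
  ⟨⟩-mono {x = x} Gx = (1ₚ , mono x) ∷ [] , Gx ∷ [] , λ m → begin
    coeff (mono x) m                        ≈⟨ coeff≈pairing-δ (mono x) m ⟩
    pairing (δ m) (mono x)                  ≈⟨ *-identityˡ _ ⟨
    1# * pairing (δ m) (mono x)             ≈⟨ pairing-scale (δ m) 1# (mono x) ⟨
    pairing (δ m) (1ₚ *ₚ mono x)            ≈⟨ coeff≈pairing-δ (1ₚ *ₚ mono x) m ⟨
    coeff (1ₚ *ₚ mono x) m                  ≈⟨ +-identityʳ _ ⟨
    coeff (1ₚ *ₚ mono x) m + 0#             ≈⟨ coeff-++ (1ₚ *ₚ mono x) [] m ⟨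
    coeff (combination ((1ₚ , mono x) ∷ [])) m ∎

  *ₚ-mono-/ᵐ : ∀ h {b x} → b ∣ᵐ x → (h *ₚ mono x) ≋ ((h *ₚ mono (x /ᵐ b)) *ₚ mono b)
  *ₚ-mono-/ᵐ h {b} {x} b∣x m = begin
    coeff (h *ₚ mono x) m                               ≈⟨ coeff≈pairing-δ (h *ₚ mono x) m ⟩
    pairing (δ m) (h *ₚ mono x)                         ≈⟨ pairing-*ₚ-mono (δ m) h x ⟩
    pairing (λ u → δ m (u ·ᵐ x)) h                      ≈⟨ pairing-cong h (λ {t} _ → reflexive (≡.cong (δ m) (reassociate (proj₂ t)))) ⟩
    pairing (λ u → δ m ((u ·ᵐ (x /ᵐ b)) ·ᵐ b)) h        ≈⟨ pairing-*ₚ-mono (λ u → δ m (u ·ᵐ b)) h (x /ᵐ b) ⟨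
    pairing (λ u → δ m (u ·ᵐ b)) (h *ₚ mono (x /ᵐ b))   ≈⟨ pairing-*ₚ-mono (δ m) (h *ₚ mono (x /ᵐ b)) b ⟨
    pairing (δ m) ((h *ₚ mono (x /ᵐ b)) *ₚ mono b)      ≈⟨ coeff≈pairing-δ ((h *ₚ mono (x /ᵐ b)) *ₚ mono b) m ⟨
    coeff ((h *ₚ mono (x /ᵐ b)) *ₚ mono b) m            ∎
    where
    reassociate : ∀ u → u ·ᵐ x ≡ (u ·ᵐ (x /ᵐ b)) ·ᵐ b
    reassociate u = ≡.trans (≡.cong (u ·ᵐ_) (≡.sym (/ᵐ-·ᵐ b∣x))) (≡.sym (·ᵐ-assoc u (x /ᵐ b) b))

  ⟨⟩-monomial-⊆ : ∀ {G₁ G₂ : PSet} →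
                  (∀ {g} → G₁ g → Σ (Mono n) λ x → Σ (Mono n) λ b → g ≡ mono x × b ∣ᵐ x × G₂ (mono b)) →
                  ∀ {f} → ⟨ G₁ ⟩ f → ⟨ G₂ ⟩ f
  ⟨⟩-monomial-⊆ {G₁} {G₂} divisible (hs , gens , f≋) =
    let hs′ , gens′ , hs≋hs′ = divide hs gens in hs′ , gens′ , λ m → trans (f≋ m) (hs≋hs′ m)
    where
    divide : ∀ hs → All (G₁ ∘ proj₂) hs → Σ (List (Pol × Pol)) λ hs′ → All (G₂ ∘ proj₂) hs′ × combination hs ≋ combination hs′
    divide []             []            = [] , [] , λ _ → refl
    divide ((h , g) ∷ hs) (G₁g ∷ gens) with divisible G₁g | divide hs gens
    ... | x , b , ≡.refl , b∣x , G₂b | hs′ , gens′ , hs≋hs′ =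
      (h *ₚ mono (x /ᵐ b) , mono b) ∷ hs′ , G₂b ∷ gens′ ,
      λ m → trans (coeff-++ (h *ₚ mono x) (combination hs) m)
              (trans (+-cong (*ₚ-mono-/ᵐ h b∣x m) (hs≋hs′ m)) (sym (coeff-++ ((h *ₚ mono (x /ᵐ b)) *ₚ mono b) (combination hs′) m)))

module StanleyReisner {c ℓ} (K : Field c ℓ) {n : ℕ} (Γ : SimplicialComplex n) where
  open Field K hiding (_-_)
  open Poly K n
  open Pairing K n
  open Ideals K n
  open SimplicialComplex Γ
  open MinimalNonFaces Γ
  open import Relation.Binary.Reasoning.Setoid setoid

  SR-generator : (Subset n → Set) → PSet
  SR-generator Δ g = Lift (c ⊔ ℓ) (∃[ F ] (¬ Δ F × g ≡ mono (squarefree F)))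

  NonFaceSupported : Pol → Set c
  NonFaceSupported = EveryMono (λ u → ¬ Face (support u))

  combination-nonFaceSupported : ∀ hs → All (SR-generator Face ∘ proj₂) hs → NonFaceSupported (combination hs)
  combination-nonFaceSupported ((h , g) ∷ hs) (lift (F , ¬face , ≡.refl) ∷ gens) t∈ with ∈-++⁻ (h *ₚ mono (squarefree F)) t∈
  ... | inj₂ t∈hs = combination-nonFaceSupported hs gens t∈hs
  ... | inj₁ t∈hF = EveryMono-*ₚ {P = λ _ → ⊤} {Q = _≡ squarefree F} {R = λ u → ¬ Face (support u)}
    h (mono (squarefree F)) _ (λ { (here ≡.refl) → ≡.refl })
    (λ {u} _ → λ { ≡.refl face → ¬face (down-closed (⊆-support-·ᵐ-squarefree u F) face) }) t∈hF

  SR-nonFaceSupported : ∀ {f} → SR-ideal K Face f → Σ Pol λ S → f ≋ S × NonFaceSupported S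
  SR-nonFaceSupported (hs , gens , f≋) = combination hs , f≋ , combination-nonFaceSupported hs gens

  mono∈SR⇒nonFace : ∀ {m} → SR-ideal K Face (mono m) → ¬ Face (support m)
  mono∈SR⇒nonFace {m} m∈ face with SR-nonFaceSupported {mono m} m∈
  ... | S , m≋S , nonFace = 1≉0 (begin
    1#                     ≈⟨ δ-≡ {m} ≡.refl ⟨
    δ m m                  ≈⟨ pairing-mono (δ m) m ⟨
    pairing (δ m) (mono m) ≈⟨ coeff≈pairing-δ (mono m) m ⟨
    coeff (mono m) m       ≈⟨ m≋S m ⟩
    coeff S m              ≈⟨ coeff-zero S m (λ t∈ → λ { ≡.refl → nonFace t∈ face }) ⟩
    0#                     ∎)

  -- The hypothesis of the theorem, in combinatorial form.
  module _ {i j : Fin n} (i≢j : i ≢ j)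
           (noMinimalGenerator : ∀ m → IsMinimalMonoGen (SR-ideal K Face) m → ¬ ((unitᵐ i ·ᵐ unitᵐ j) ∣ᵐ m)) where

    face-from-deletions : ∀ {H} → i ∈ H → j ∈ H → Face (H - i) → Face (H - j) → Face H
    face-from-deletions {H} i∈H j∈H face-i face-j with face? H
    ... | yes face = face
    ... | no ¬face with minimalNonFace ¬face
    ...   | M , M⊆H , ¬faceM , minimal = ⊥-elim (noMinimalGenerator (squarefree M)
      (⟨⟩-mono (lift (M , ¬faceM , ≡.refl)) , properDivisors)
      (unitᵐ·unitᵐ-∣ᵐ-squarefree i≢j (∈M face-i) (∈M face-j)))
      where
      ∈M : ∀ {k} → Face (H - k) → k ∈ M
      ∈M {k} face-k with k Subsetₚ.∈? M
      ... | yes k∈M = k∈M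
      ... | no  k∉M = ⊥-elim (¬faceM (down-closed (λ x∈M → Subsetₚ.x∈p∧x≢y⇒x∈p-y (M⊆H x∈M) (λ { ≡.refl → k∉M x∈M })) face-k))
      properDivisors : ∀ m′ → m′ ∣ᵐ squarefree M → m′ ≢ squarefree M → ¬ SR-ideal K Face (mono m′)
      properDivisors m′ m′∣ m′≢ m′∈ = let k , k∈M , supp⊆ = properDivisor-squarefree m′∣ m′≢ in
        mono∈SR⇒nonFace {m′} m′∈ (down-closed supp⊆ (minimal k∈M))

-- The two inclusions
module Shifted {c ℓ} (K : Field c ℓ) {n : ℕ} (Γ : SimplicialComplex n) {i j : Fin n} (i<j : toℕ i ℕ.< toℕ j)
               (face-from-deletions : ∀ {H} → i ∈ H → j ∈ H →
                  SimplicialComplex.Face Γ (H - i) → SimplicialComplex.Face Γ (H - j) → SimplicialComplex.Face Γ H) where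
  open Field K hiding (_-_)
  open Poly K n
  open Pairing K n
  open Ideals K n
  open SimplicialComplex Γ
  open StanleyReisner K Γ using (SR-generator; NonFaceSupported; SR-nonFaceSupported)
  open import Relation.Binary.Reasoning.Setoid setoid

  i≢j : i ≢ j
  i≢j i≡j = ℕₚ.<-irrefl (≡.cong toℕ i≡j) i<j

  open Shifting Γ i j i≢j
  open Block i j i≢j
  open Substitution K i j i≢j
  open ImageCoefficients K i j i≢j

  face-∪-j : ∀ {G} → Face G → i ∈ G → (j ∉ G → Face (exchange i j G)) → Face (G ∪ ⁅ j ⁆)
  face-∪-j {G} face i∈G swapFace with j Subsetₚ.∈? G
  ... | yes j∈G = down-closed (λ x∈ → [ id , (λ x∈⁅j⁆ → ≡.subst (_∈ G) (≡.sym (Subsetₚ.x∈⁅y⁆⇒x≡y j x∈⁅j⁆)) j∈G) ]′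
                                      (Subsetₚ.x∈p∪q⁻ G ⁅ j ⁆ x∈)) face
  ... | no  j∉G = face-from-deletions (Subsetₚ.p⊆p∪q ⁅ j ⁆ i∈G) (Subsetₚ.q⊆p∪q G ⁅ j ⁆ (Subsetₚ.x∈⁅x⁆ j))
                    (down-closed ⊆exchange (swapFace j∉G)) (down-closed ⊆G face)
    where
    ⊆exchange : (G ∪ ⁅ j ⁆) - i ⊆ exchange i j G
    ⊆exchange x∈ = ∈-exchange⁺ ([ (λ x∈G → inj₁ (x∈G , x∈p-y⇒x≢y x∈)) , inj₂ ∘ Subsetₚ.x∈⁅y⁆⇒x≡y j ]′
                                  (Subsetₚ.x∈p∪q⁻ G ⁅ j ⁆ (Subsetₚ.p─q⊆p _ ⁅ i ⁆ x∈)))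
    ⊆G : (G ∪ ⁅ j ⁆) - j ⊆ G
    ⊆G x∈ = [ id , (λ x∈⁅j⁆ → ⊥-elim (x∈p-y⇒x≢y x∈ (Subsetₚ.x∈⁅y⁆⇒x≡y j x∈⁅j⁆))) ]′
              (Subsetₚ.x∈p∪q⁻ G ⁅ j ⁆ (Subsetₚ.p─q⊆p _ ⁅ j ⁆ x∈))

  leading-support-∉Shift : ∀ S {m} → NonFaceSupported S → IsLeadingMono (φ i j S) m → ¬ Shift Γ i j (support m)
  leading-support-∉Shift S {m} nonFace lead@(c≉0 , _) shifted with Shift⁻ shifted | lookup m i in mᵢ≡
  ... | inj₁ (face , _) | zero = c≉0 (coeff-φ-zero S m (λ {t} t∈ b →
    ℕₚ.≰⇒> (λ mⱼ≤ → nonFace t∈ (≡.subst (Face ∘ support) (≡.sym (SameBlock-top mᵢ≡ b mⱼ≤)) face))))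
  ... | inj₁ (face , swapFace) | suc _ = c≉0 (coeff-φ-zero S m (λ {t} t∈ b →
    ⊥-elim (nonFace t∈ (down-closed (support-SameBlock-⊆ b i∈) (face-∪-j face i∈ (swapFace i∈))))))
    where
    i∈ : i ∈ support m
    i∈ = ∈-support⁺ {v = m} (≡.subst (0 ℕ.<_) (≡.sym mᵢ≡) (s≤s z≤n))
  ... | inj₂ (_ , _ , faceBack) | zero = leading-φ-alternating i<j S mᵢ≡ (λ {t} t∈ b →
    ℕₚ.n≢0⇒n>0 (λ uⱼ≡0 → nonFace t∈ (down-closed (support-SameBlock-⊆-exchange b uⱼ≡0) faceBack))) lead
  ... | inj₂ (_ , i∉ , _) | suc _ = i∉ (∈-support⁺ {v = m} (≡.subst (0 ℕ.<_) (≡.sym mᵢ≡) (s≤s z≤n)))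

  initial⊆shifted : ∀ {f} → initialIdeal (φImage i j (SR-ideal K Face)) f → SR-ideal K (Shift Γ i j) f
  initial⊆shifted {f} = ⟨⟩-monomial-⊆ divisible {f}
    where
    divisible : ∀ {g} → ∃[ f′ ] ∃[ m ] (φImage i j (SR-ideal K Face) f′ × IsLeadingMono f′ m × g ≡ mono m) →
                Σ (Mono n) λ x → Σ (Mono n) λ b → g ≡ mono x × b ∣ᵐ x × SR-generator (Shift Γ i j) (mono b)
    divisible (f′ , m , (p , p∈I , f′≋φp) , lead , ≡.refl) =
      let S , p≋S , nonFace = SR-nonFaceSupported {p} p∈I
          φS≋f′ = λ y → sym (trans (f′≋φp y) (φ-cong {p} {S} p≋S y))
      in m , squarefree (support m) , ≡.refl , squarefree-support-∣ᵐ m ,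
         lift (support m , leading-support-∉Shift S nonFace (IsLeadingMono-cong {φ i j S} {f′} φS≋f′ lead) , ≡.refl)

  LeadingWitness : Subset n → Set (c ⊔ ℓ)
  LeadingWitness H = Σ Pol λ f′ → φImage i j (SR-ideal K Face) f′ × IsLeadingMono f′ (squarefree H)

  witness-generator : ∀ {F H} → ¬ Face F → SameBlock (squarefree F) (squarefree H) → j ∉ H → LeadingWitness H
  witness-generator {F} {H} ¬face b j∉H =
    φ i j (mono (squarefree F)) , (mono (squarefree F) , ⟨⟩-mono (lift (F , ¬face , ≡.refl)) , λ _ → refl) ,
    IsLeadingMono-cong {φ i j (mono (squarefree F))} {φᵐ (squarefree F)} (φ-mono (squarefree F)) (φᵐ-leading i<j b (lookup-squarefree-∉ j∉H))

  -- For B = (H \ {j}) ∪ {i}, x_H and x_B share a block; the tops of their images cancel in φ(x_H − x_B).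
  witness-binomial : ∀ {H} → ¬ Face H → j ∈ H → i ∉ H → ¬ Face (exchange j i H) → LeadingWitness H
  witness-binomial {H} ¬faceH j∈H i∉H ¬faceB = φ i j f , (f , f∈I , λ _ → refl) , leading
    where
    B = exchange j i H
    hs : List (Pol × Pol)
    hs = (1ₚ , mono (squarefree H)) ∷ (((- 1# , one) ∷ []) , mono (squarefree B)) ∷ []
    f : Pol
    f = combination hs
    f∈I : SR-ideal K Face f
    f∈I = hs , lift (H , ¬faceH , ≡.refl) ∷ lift (B , ¬faceB , ≡.refl) ∷ [] , λ _ → refl

    term : ∀ w a x → pairing w (((a , one) ∷ []) *ₚ mono x) ≈ a * w x
    term w a x = trans (pairing-scale w a (mono x)) (*-congˡ (pairing-mono w x))

    coeff-φf : ∀ y → coeff (φ i j f) y ≈ 1# * coeff (φᵐ (squarefree H)) y + - 1# * coeff (φᵐ (squarefree B)) y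
    coeff-φf y = begin
      coeff (φ i j f) y                   ≈⟨ coeff-φ≈pairing f y ⟩
      pairing w (xH ++ (xB ++ []))        ≈⟨ pairing-++ w xH (xB ++ []) ⟩
      pairing w xH + pairing w (xB ++ []) ≈⟨ +-congˡ (trans (pairing-++ w xB []) (+-identityʳ _)) ⟩
      pairing w xH + pairing w xB         ≈⟨ +-cong (term w 1# (squarefree H)) (term w (- 1#) (squarefree B)) ⟩
      1# * w (squarefree H) + - 1# * w (squarefree B) ∎
      where
      w : Mono n → Carrier
      w u = coeff (φᵐ u) y
      xH = 1ₚ *ₚ mono (squarefree H)
      xB = ((- 1# , one) ∷ []) *ₚ mono (squarefree B)

    j∉B : j ∉ B
    j∉B = ∉-exchange (≡.≢-sym i≢j)

    B≈H : SameBlock (squarefree H) (squarefree B)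
    B≈H = ≡.subst (λ G → SameBlock G (squarefree B)) (≡.cong squarefree (exchange-exchange j∈H i∉H))
            (SameBlock-sym (SameBlock-exchange (∈-exchange⁺ (inj₂ ≡.refl)) j∉B))

    Hⱼ≡1 : lookup (squarefree H) j ≡ 1
    Hⱼ≡1 = lookup-squarefree-∈ j∈H

    leading : IsLeadingMono (φ i j f) (squarefree H)
    leading = (λ c≈0 → 1≉0 (trans (sym c≈1) c≈0)) , above
      where
      Bⱼ<Hⱼ : lookup (squarefree B) j ℕ.< lookup (squarefree H) j
      Bⱼ<Hⱼ = ≡.subst₂ ℕ._<_ (≡.sym (lookup-squarefree-∉ j∉B)) (≡.sym Hⱼ≡1) (s≤s z≤n)
      c≈1 : coeff (φ i j f) (squarefree H) ≈ 1#
      c≈1 = trans (coeff-φf (squarefree H)) (trans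
        (+-cong (trans (*-identityˡ _) (coeff-φᵐ-self (squarefree H) (lookup-squarefree-∉ i∉H)))
                (trans (*-congˡ (coeff-φᵐ-aboveʲ (squarefree B) (squarefree H) Bⱼ<Hⱼ)) (zeroʳ _)))
        (+-identityʳ 1#))
      above : ∀ m′ → squarefree H <drl m′ → coeff (φ i j f) m′ ≈ 0#
      above m′ H<m′ with sameBlock? (squarefree H) m′
      ... | no ¬b = trans (coeff-φf m′) (trans
        (+-cong (trans (*-identityˡ _) (coeff-φᵐ-outside _ m′ ¬b))
                (trans (*-congˡ (coeff-φᵐ-outside _ m′ (¬b ∘ SameBlock-trans B≈H))) (zeroʳ _)))
        (+-identityʳ 0#))
      ... | yes b = trans (coeff-φf m′) (trans
        (+-cong (*-congˡ (coeff-φᵐ-bottom b m′ⱼ≡0)) (*-congˡ (coeff-φᵐ-bottom (SameBlock-trans (SameBlock-sym B≈H) b) m′ⱼ≡0)))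
        (trans (+-cong (*-identityʳ 1#) (*-identityʳ (- 1#))) (-‿inverseʳ 1#)))
        where
        m′ⱼ≡0 : lookup m′ j ≡ 0
        m′ⱼ≡0 = ℕₚ.n<1⇒n≡0 (≡.subst (lookup m′ j ℕ.<_) Hⱼ≡1 (SameBlock-<drl⇒ i<j b H<m′))

  witness-below : ∀ {G} → ¬ Shift Γ i j G → Σ (Subset n) λ H → H ⊆ G × LeadingWitness H
  witness-below {G} ¬shifted with face? G
  ... | yes face with i Subsetₚ.∈? G | j Subsetₚ.∈? G | face? (exchange i j G)
  ...   | yes i∈G | no  j∉G | no ¬swap = G , id , witness-generator ¬swap (SameBlock-sym (SameBlock-exchange i∈G j∉G)) j∉G
  ...   | yes _   | no  _   | yes swap = ⊥-elim (¬shifted (Shift⁺-face face (λ _ _ → swap)))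
  ...   | yes _   | yes j∈G | _        = ⊥-elim (¬shifted (Shift⁺-face face (λ _ j∉G → ⊥-elim (j∉G j∈G))))
  ...   | no  i∉G | _       | _        = ⊥-elim (¬shifted (Shift⁺-face face (λ i∈G → ⊥-elim (i∉G i∈G))))
  witness-below {G} ¬shifted | no ¬face with j Subsetₚ.∈? G
  ... | no  j∉G = G , id , witness-generator ¬face SameBlock-refl j∉G
  ... | yes j∈G with i Subsetₚ.∈? G
  ...   | no i∉G with face? (exchange j i G)
  ...     | yes faceB = ⊥-elim (¬shifted (Shift⁺-back j∈G i∉G faceB))
  ...     | no ¬faceB = G , id , witness-binomial ¬face j∈G i∉G ¬faceB
  witness-below {G} ¬shifted | no ¬face | yes j∈G | yes i∈G with face? (G - j)
  ... | no ¬face-j = G - j , Subsetₚ.p─q⊆p G ⁅ j ⁆ , witness-generator ¬face-j SameBlock-refl x∉p-x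
  ... | yes face-j = G - j , Subsetₚ.p─q⊆p G ⁅ j ⁆ ,
    witness-generator ¬swap (SameBlock-sym (SameBlock-exchange (Subsetₚ.x∈p∧x≢y⇒x∈p-y i∈G i≢j) x∉p-x)) x∉p-x
    where
    G-i⊆ : G - i ⊆ exchange i j (G - j)
    G-i⊆ {x} x∈ with x ≟ j
    ... | yes x≡j = ∈-exchange⁺ (inj₂ x≡j)
    ... | no  x≢j = ∈-exchange⁺ (inj₁ (Subsetₚ.x∈p∧x≢y⇒x∈p-y (Subsetₚ.p─q⊆p G ⁅ i ⁆ x∈) x≢j , x∈p-y⇒x≢y x∈))
    ¬swap : ¬ Face (exchange i j (G - j))
    ¬swap swap = ¬face (face-from-deletions i∈G j∈G (down-closed G-i⊆ swap) face-j)

  shifted⊆initial : ∀ {f} → SR-ideal K (Shift Γ i j) f → initialIdeal (φImage i j (SR-ideal K Face)) f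
  shifted⊆initial {f} = ⟨⟩-monomial-⊆ divisible {f}
    where
    divisible : ∀ {g} → SR-generator (Shift Γ i j) g → Σ (Mono n) λ x → Σ (Mono n) λ b → g ≡ mono x × b ∣ᵐ x ×
                ∃[ f′ ] ∃[ m ] (φImage i j (SR-ideal K Face) f′ × IsLeadingMono f′ m × mono b ≡ mono m)
    divisible (lift (G , ¬shifted , ≡.refl)) =
      let H , H⊆G , f′ , f′∈ , lead = witness-below ¬shifted
      in squarefree G , squarefree H , ≡.refl , squarefree-∣ᵐ H⊆G , f′ , squarefree H , f′∈ , lead , ≡.refl

lemma2p2 : ∀ {c ℓ : Level} (K : Field c ℓ) {n : ℕ} (Γ : SimplicialComplex n) (i j : Fin n) →
    i Fin.< j →
    (∀ m → Poly.IsMinimalMonoGen K n (SR-ideal K (SimplicialComplex.Face Γ)) m →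
      ¬ ((unitᵐ i ·ᵐ unitᵐ j) ∣ᵐ m)) →
    ∀ f →
      (Poly.initialIdeal K n (Poly.φImage K n i j (SR-ideal K (SimplicialComplex.Face Γ))) f →
        SR-ideal K (Shift Γ i j) f)
      × (SR-ideal K (Shift Γ i j) f →
        Poly.initialIdeal K n (Poly.φImage K n i j (SR-ideal K (SimplicialComplex.Face Γ))) f)
lemma2p2 K Γ i j i<j noMinimalGenerator f = initial⊆shifted {f} , shifted⊆initial {f}
  where
  open Shifted K Γ i<j (StanleyReisner.face-from-deletions K Γ (λ i≡j → ℕₚ.<-irrefl (≡.cong toℕ i≡j) i<j) noMinimalGenerator)
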